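{- Let $\sigma\subseteq\overline{M}_{\mathbb R}$ be a reflexive Gorenstein cone of index $r$ with support $\tilde\Delta$, and let $\tilde\Delta^*:=\sigma^\vee\cap\{y:\langle m_{\sigma^\vee},y\rangle=1\}$ be the support of $\sigma^\vee$. The following are equivalent: (1) $\sigma$ is completely split; (2) there exist lattice points $e_1^*,\dots,e_r^*\in\tilde\Delta^*\cap\overline{N}$ such that $e_1^*+\dots+e_r^*=n_\sigma$. Moreover, there is a one-to-one correspondence between all possible collections $\{e_1^*,\dots,e_r^*\}$ of $r$ lattice points in $\tilde\Delta^*$ with $e_1^*+\dots+e_r^*=n_\sigma$ and all possible Cayley polytope structures of length $r$ of the Gorenstein polytope $\tilde\Delta$.
   Context: $\overline{M},\overline{N}$ are dual lattices. A Gorenstein cone $\sigma\subseteq\overline{M}_{\mathbb R}$ is a full-dimensional rational polyhedral cone with apex $0$ generated by lattice points lying in a hyperplane $\{\langle x,n_\sigma\rangle=1\}$, $n_\sigma\in\overline{N}$ (unique); its support is $\sigma\cap\{\langle x,n_\sigma\rangle=1\}$. It is reflexive if the dual cone $\sigma^\vee$ is Gorenstein too; $m_{\sigma^\vee}\in\overline{M}$ is the corresponding lattice point for $\sigma^\vee$, and the index is $r=\langle m_{\sigma^\vee},n_\sigma\rangle$. $\sigma$ is completely split if it is a Cayley cone associated to $r$ lattice polytopes: i.e., there is a lattice isomorphism $\overline{M}\cong M\oplus\mathbb{Z}^r$ and lattice polytopes $\Delta_1,\dots,\Delta_r\subseteq M_{\mathbb R}$ with $\sigma$ corresponding to $\sum_i\mathbb{R}_{\ge0}(\Delta_i\times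 e_i)$, $e_i$ the standard basis of $\mathbb{Z}^r$. A Cayley polytope structure of length $r$ on $\tilde\Delta$ is an identification (by an affine lattice isomorphism) of $\tilde\Delta$ with a Cayley polytope $\Delta_1*\dots*\Delta_r=\mathrm{Conv}(\Delta_1\times e_1,\dots,\Delta_r\times e_r)$, equivalently a lattice projection of the affine lattice of $\tilde\Delta$ onto $\mathbb{Z}^r$ mapping $\tilde\Delta$ onto $\mathrm{Conv}(e_1,\dots,e_r)$.
   Formalization: The cones σ and σ^∨, the supports Δ̃ and Δ̃*, the Cayley cones and the simplex Conv(e_1,…,e_r) are taken as sets of rational points rather than real points. -}

module Defs where

open import Data.Nat using (ℕ; zero; suc; _+_)
open import Data.Integer as ℤ using (ℤ; +_)
open import Data.Rational as ℚ using (ℚ; 0ℚ; 1ℚ)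
open import Data.Fin using (Fin; zero; suc; splitAt; _≟_)
open import Data.Sum using ([_,_]′)
open import Data.Product using (Σ; _×_; _,_; proj₁)
open import Data.Bool using (if_then_else_)
open import Relation.Nullary.Decidable using (⌊_⌋)
open import Relation.Binary.PropositionalEquality using (_≡_)

-- Lattice vectors (points of M̄ ≅ ℤ^d or N̄ ≅ ℤ^d) and rational vectors.
Vecℤ : ℕ → Set
Vecℤ d = Fin d → ℤ

Vecℚ : ℕ → Set
Vecℚ d = Fin d → ℚ

_⇔_ : Set → Set → Set
A ⇔ B = (A → B) × (B → A)
infix 2 _⇔_

sumℤ : ∀ {k} → (Fin k → ℤ) → ℤ
sumℤ {zero} f = + 0
sumℤ {suc k} f = f zero ℤ.+ sumℤ (λ j → f (suc j))

sumℚ : ∀ {k} → (Fin k → ℚ) → ℚ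
sumℚ {zero} f = 0ℚ
sumℚ {suc k} f = f zero ℚ.+ sumℚ (λ j → f (suc j))

toℚ : ∀ {d} → Vecℤ d → Vecℚ d
toℚ v i = v i ℚ./ 1

dotℤ : ∀ {d} → Vecℤ d → Vecℤ d → ℤ
dotℤ x y = sumℤ (λ i → x i ℤ.* y i)

dotℚ : ∀ {d} → Vecℚ d → Vecℚ d → ℚ
dotℚ x y = sumℚ (λ i → x i ℚ.* y i)

unit : ∀ {r} → Fin r → Vecℤ r
unit i s = if ⌊ i ≟ s ⌋ then + 1 else + 0

InCone : ∀ {d k} → (Fin k → Vecℚ d) → Vecℚ d → Set
InCone {d} {k} g x =
  Σ (Fin k → ℚ) λ c → (∀ j → 0ℚ ℚ.≤ c j) × (∀ i → x i ≡ sumℚ (λ j → c j ℚ.* g j i))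

InConv : ∀ {d k} → (Fin k → Vecℚ d) → Vecℚ d → Set
InConv {d} {k} g x =
  Σ (Fin k → ℚ) λ c → (∀ j → 0ℚ ℚ.≤ c j) × (sumℚ c ≡ 1ℚ)
    × (∀ i → x i ≡ sumℚ (λ j → c j ℚ.* g j i))

FullDim : ∀ {d} → (Vecℚ d → Set) → Set
FullDim {d} C = ∀ (x : Vecℚ d) → Σ (Vecℚ d) λ a → Σ (Vecℚ d) λ b →
  C a × C b × (∀ i → x i ≡ a i ℚ.- b i)

IsGorenstein : ∀ {d} → (Vecℚ d → Set) → Vecℤ d → Set
IsGorenstein {d} C n = Σ ℕ λ k → Σ (Fin k → Vecℤ d) λ g →
  (∀ j → dotℤ (g j) n ≡ + 1)
  × (∀ x → C x ⇔ InCone (λ j → toℚ (g j)) x)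
  × FullDim C

Dual : ∀ {d} → (Vecℚ d → Set) → Vecℚ d → Set
Dual {d} C y = ∀ (x : Vecℚ d) → C x → 0ℚ ℚ.≤ dotℚ x y

Support : ∀ {d} → (Vecℚ d → Set) → Vecℤ d → Vecℚ d → Set
Support C n x = C x × dotℚ x (toℚ n) ≡ 1ℚ

DualSupportPt : ∀ {d} → (Vecℚ d → Set) → Vecℤ d → Vecℤ d → Set
DualSupportPt C m y = Dual C (toℚ y) × dotℤ m y ≡ + 1

LatticeIso : ℕ → ℕ → Set
LatticeIso d d' = Σ (Fin d' → Fin d → ℤ) λ A → Σ (Fin d → Fin d' → ℤ) λ B →
  (∀ i i' → sumℤ (λ j → A i j ℤ.* B j i') ≡ unit i i')
  × (∀ j j' → sumℤ (λ i → B j i ℤ.* A i j') ≡ unit j j')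

applyIso : ∀ {d d'} → LatticeIso d d' → Vecℚ d → Vecℚ d'
applyIso (A , _) x i = sumℚ (λ j → (A i j ℚ./ 1) ℚ.* x j)

liftPt : ∀ {e r} → Vecℤ e → Fin r → Vecℤ (e + r)
liftPt {e} u i t = [ u , unit i ]′ (splitAt e t)

-- Cayley cone Σ_i ℝ≥0 (Δ_i × e_i), where Δ_i = Conv(V i 0, …, V i (k i - 1)).
CayleyCone : ∀ {e r} (k : Fin r → ℕ) → ((i : Fin r) → Fin (k i) → Vecℤ e)
  → Vecℚ (e + r) → Set
CayleyCone {e} {r} k V y = Σ (Fin r → Vecℚ (e + r)) λ c →
  (∀ i → InCone (λ j → toℚ (liftPt (V i j) i)) (c i))
  × (∀ t → y t ≡ sumℚ (λ i → c i t))

CompletelySplit : ∀ {d} → (Vecℚ d → Set) → ℕ → Set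
CompletelySplit {d} σ r = Σ ℕ λ e → Σ (LatticeIso d (e + r)) λ φ →
  Σ (Fin r → ℕ) λ k → Σ ((i : Fin r) → Fin (k i) → Vecℤ e) λ V →
  ∀ x → σ x ⇔ CayleyCone k V (applyIso φ x)

IsSplitting : ∀ {d r} → (Vecℚ d → Set) → Vecℤ d → Vecℤ d → (Fin r → Vecℤ d) → Set
IsSplitting σ n m E = (∀ i → DualSupportPt σ m (E i)) × (∀ t → sumℤ (λ i → E i t) ≡ n t)

-- An affine lattice map on {x ∈ M̄ : ⟨x , n⟩ = 1} to ℤ^r, given by the integer
-- matrix L (rows L i); and its extension to rational points.
applyℤ : ∀ {d r} → (Fin r → Vecℤ d) → Vecℤ d → Vecℤ r
applyℤ L x i = dotℤ (L i) x

applyℚ : ∀ {d r} → (Fin r → Vecℤ d) → Vecℚ d → Vecℚ r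
applyℚ L x i = dotℚ (toℚ (L i)) x

-- Cayley polytope structure of length r on Δ̃: a lattice projection of the affine
-- lattice {x ∈ M̄ : ⟨x , n_σ⟩ = 1} of Δ̃ onto the affine lattice {z ∈ ℤ^r : Σ z = 1}
-- of Conv(e_1,…,e_r), mapping Δ̃ onto Conv(e_1,…,e_r).
IsCayleyStructure : ∀ {d r} → (Vecℚ d → Set) → Vecℤ d → (Fin r → Vecℤ d) → Set
IsCayleyStructure {d} {r} σ n L =
  (∀ x → dotℤ x n ≡ + 1 → sumℤ (applyℤ L x) ≡ + 1)
  × (∀ (z : Vecℤ r) → sumℤ z ≡ + 1 →
       Σ (Vecℤ d) λ x → dotℤ x n ≡ + 1 × (∀ i → applyℤ L x i ≡ z i))
  × (∀ x → Support σ n x → InConv (λ i → toℚ (unit i)) (applyℚ L x))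
  × (∀ (z : Vecℚ r) → InConv (λ i → toℚ (unit i)) z →
       Σ (Vecℚ d) λ x → Support σ n x × (∀ i → applyℚ L x i ≡ z i))

-- Bijection between two types of structured data, compared on the underlying data.
Splittings : ∀ {d} → (Vecℚ d → Set) → Vecℤ d → Vecℤ d → ℕ → Set
Splittings {d} σ n m r = Σ (Fin r → Vecℤ d) (IsSplitting σ n m)

CayleyStructures : ∀ {d} → (Vecℚ d → Set) → Vecℤ d → ℕ → Set
CayleyStructures {d} σ n r = Σ (Fin r → Vecℤ d) (IsCayleyStructure σ n)

Correspondence : ∀ {d} → (Vecℚ d → Set) → Vecℤ d → Vecℤ d → ℕ → Set
Correspondence σ n m r =
  Σ (Splittings σ n m r → CayleyStructures σ n r) λ Φ →
  Σ (CayleyStructures σ n r → Splittings σ n m r) λ Ψ →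
    (∀ E → ∀ i t → proj₁ (Ψ (Φ E)) i t ≡ proj₁ E i t)
    × (∀ S → ∀ i t → proj₁ (Φ (Ψ S)) i t ≡ proj₁ S i t)

-- A splitting and a Cayley structure are the same r × d integer matrix E. If the rows Eᵢ lie in σ^∨ and sum
-- to n_σ, then on every generator g of σ the values ⟨g , Eᵢ⟩ are nonnegative integers summing to 1, i.e. E
-- maps each generator to a vertex of the simplex, so E maps Δ̃ onto Conv(e₁,…,e_r). Conversely the rows of a
-- Cayley structure are nonnegative on Δ̃, agree with n_σ on the generators, and, being nonzero lattice points
-- of σ^∨, satisfy ⟨m_{σ^∨} , Eᵢ⟩ ≥ 1 with total ⟨m_{σ^∨} , n_σ⟩ = r, forcing each value to be 1.
-- A Cayley decomposition σ ≅ Σ ℝ≥0 (Δᵢ × eᵢ) yields such rows as the last r coordinate functionals. In the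
-- other direction, the generators over the vertices form a right inverse of E, so E extends to a lattice
-- basis (by column reduction with Euclid's algorithm); in that basis σ is the Cayley cone of the projected
-- generators.

module Submission where

open import Defs
open import Data.Nat as ℕ using (ℕ; zero; suc; z≤n; s≤s) renaming (_+_ to _+ℕ_)
import Data.Nat.Properties as ℕP
open import Data.Nat.Coprimality using (1-coprimeTo) renaming (sym to coprime-sym)
open import Data.Integer as ℤ using (ℤ; +_; -[1+_])
import Data.Integer.Properties as ℤP
open import Data.Integer.DivMod using (_/_; _%_; a≡a%n+[a/n]*n; n%d<d)
open import Data.Integer.Tactic.RingSolver using (solve-∀)
open import Data.Rational as ℚ using (ℚ; 0ℚ; 1ℚ; mkℚ)
import Data.Rational.Properties as ℚP
open import Data.Fin as Fin using (Fin; zero; suc; _↑ˡ_; _↑ʳ_; splitAt; join)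
open import Data.Fin.Properties
  using (suc-injective; any?; ¬∀⟶∃¬; splitAt-↑ˡ; splitAt-↑ʳ; splitAt⁻¹-↑ˡ; splitAt⁻¹-↑ʳ; join-splitAt;
         ↑ˡ-injective; ↑ʳ-injective)
open import Data.Product using (Σ; _×_; _,_; proj₁; proj₂)
open import Data.Sum using (_⊎_; inj₁; inj₂; [_,_]′)
open import Data.Empty using (⊥-elim)
open import Relation.Nullary using (¬_; yes; no)
open import Relation.Binary.PropositionalEquality
open import Algebra.Bundles using (CommutativeRing)
open import Algebra.Structures using (IsCommutativeRing)
open ≡-Reasoning

-- Finite sums and matrices over a commutative ring

-- Σ and δ are parameters rather than definitions so that sumℤ, sumℚ and unit from Defs
-- are instances up to definitional equality.
module RingSums {A : Set} {add mul : A → A → A} {neg : A → A} {zero# one# : A}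
  (isCommutativeRing : IsCommutativeRing _≡_ add mul neg zero# one#)
  (Σ : ∀ {k} → (Fin k → A) → A)
  (Σ-empty : (f : Fin 0 → A) → Σ f ≡ zero#)
  (Σ-suc : ∀ {k} (f : Fin (suc k) → A) → Σ f ≡ add (f zero) (Σ (λ j → f (suc j))))
  (δ : ∀ {n} → Fin n → Fin n → A)
  (δ-diag : ∀ {n} (i : Fin n) → δ i i ≡ one#)
  (δ-offdiag : ∀ {n} {i j : Fin n} → ¬ i ≡ j → δ i j ≡ zero#) where

  ring : CommutativeRing _ _
  ring = record { isCommutativeRing = isCommutativeRing }

  open CommutativeRing ring public
    using (_+_; _*_; -_; 0#; 1#; +-assoc; +-comm; +-identityˡ; +-identityʳ; *-assoc; *-comm; *-identityˡ; *-identityʳ;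
           distribˡ; distribʳ; zeroˡ; zeroʳ; -‿inverseʳ)
  open import Algebra.Properties.Ring (CommutativeRing.ring ring) public
    using (-‿distribˡ-*; -‿distribʳ-*; +-inverseʳ-unique; x∙y⁻¹≈ε⇒x≈y)
  open import Algebra.Properties.Semiring.Sum (CommutativeRing.semiring ring)
    using (sum; sum-cong-≗; sum-replicate-zero; ∑-distrib-+; ∑-comm; *-distribˡ-sum; *-distribʳ-sum)

  infixl 6 _-_
  _-_ : A → A → A
  a - b = a + - b

  Σ≗sum : ∀ {k} (f : Fin k → A) → Σ f ≡ sum f
  Σ≗sum {zero} f = Σ-empty f
  Σ≗sum {suc k} f = trans (Σ-suc f) (cong (_+_ (f zero)) (Σ≗sum (λ j → f (suc j))))

  Σ-cong : ∀ {k} {f g : Fin k → A} → (∀ i → f i ≡ g i) → Σ f ≡ Σ g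
  Σ-cong {f = f} {g} f≗g = trans (Σ≗sum f) (trans (sum-cong-≗ f≗g) (sym (Σ≗sum g)))

  Σ-zero : ∀ {k} {f : Fin k → A} → (∀ i → f i ≡ 0#) → Σ f ≡ 0#
  Σ-zero {k} f≗0 = trans (Σ-cong f≗0) (trans (Σ≗sum _) (sum-replicate-zero k))

  Σ-distrib-+ : ∀ {k} (f g : Fin k → A) → Σ (λ i → f i + g i) ≡ Σ f + Σ g
  Σ-distrib-+ f g = begin
    Σ (λ i → f i + g i) ≡⟨ Σ≗sum _ ⟩
    sum (λ i → f i + g i) ≡⟨ ∑-distrib-+ f g ⟩
    sum f + sum g ≡⟨ sym (cong₂ _+_ (Σ≗sum f) (Σ≗sum g)) ⟩
    Σ f + Σ g ∎

  *-distribˡ-Σ : ∀ {k} (c : A) (f : Fin k → A) → c * Σ f ≡ Σ (λ i → c * f i)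
  *-distribˡ-Σ c f = trans (cong (c *_) (Σ≗sum f)) (trans (*-distribˡ-sum c f) (sym (Σ≗sum _)))

  *-distribʳ-Σ : ∀ {k} (c : A) (f : Fin k → A) → Σ f * c ≡ Σ (λ i → f i * c)
  *-distribʳ-Σ c f = trans (cong (_* c) (Σ≗sum f)) (trans (*-distribʳ-sum c f) (sym (Σ≗sum _)))

  Σ-comm : ∀ {k l} (f : Fin k → Fin l → A) → Σ (λ i → Σ (f i)) ≡ Σ (λ j → Σ (λ i → f i j))
  Σ-comm f = begin
    Σ (λ i → Σ (f i)) ≡⟨ trans (Σ-cong (λ i → Σ≗sum (f i))) (Σ≗sum _) ⟩
    sum (λ i → sum (f i)) ≡⟨ ∑-comm f ⟩
    sum (λ j → sum (λ i → f i j)) ≡⟨ sym (trans (Σ-cong (λ j → Σ≗sum _)) (Σ≗sum _)) ⟩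
    Σ (λ j → Σ (λ i → f i j)) ∎

  Σ-neg : ∀ {k} (f : Fin k → A) → Σ (λ i → - f i) ≡ - Σ f
  Σ-neg f = +-inverseʳ-unique (Σ f) _
    (trans (sym (Σ-distrib-+ f _)) (Σ-zero (λ i → -‿inverseʳ (f i))))

  δ-suc : ∀ {n} (i j : Fin n) → δ (suc i) (suc j) ≡ δ i j
  δ-suc i j with i Fin.≟ j
  ... | yes refl = trans (δ-diag _) (sym (δ-diag _))
  ... | no i≢j = trans (δ-offdiag (λ eq → i≢j (suc-injective eq))) (sym (δ-offdiag i≢j))

  Σ-δˡ : ∀ {k} (i : Fin k) (f : Fin k → A) → Σ (λ j → δ i j * f j) ≡ f i
  Σ-δˡ {suc k} i f = trans (Σ-suc _) (go i)
    where
    go : ∀ i → δ i zero * f zero + Σ (λ j → δ i (suc j) * f (suc j)) ≡ f i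
    go zero = begin
      δ zero zero * f zero + Σ (λ j → δ zero (suc j) * f (suc j))
        ≡⟨ cong₂ _+_ (cong (_* f zero) (δ-diag zero))
             (Σ-zero (λ j → trans (cong (_* f (suc j)) (δ-offdiag (λ ()))) (zeroˡ _))) ⟩
      1# * f zero + 0# ≡⟨ trans (+-identityʳ _) (*-identityˡ _) ⟩
      f zero ∎
    go (suc i) = begin
      δ (suc i) zero * f zero + Σ (λ j → δ (suc i) (suc j) * f (suc j))
        ≡⟨ cong₂ _+_ (trans (cong (_* f zero) (δ-offdiag (λ ()))) (zeroˡ _))
             (Σ-cong (λ j → cong (_* f (suc j)) (δ-suc i j))) ⟩
      0# + Σ (λ j → δ i j * f (suc j)) ≡⟨ trans (+-identityˡ _) (Σ-δˡ i (λ j → f (suc j))) ⟩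
      f (suc i) ∎

  δ-sym : ∀ {n} (i j : Fin n) → δ i j ≡ δ j i
  δ-sym i j with i Fin.≟ j
  ... | yes refl = refl
  ... | no i≢j = trans (δ-offdiag i≢j) (sym (δ-offdiag (λ eq → i≢j (sym eq))))

  Σ-δʳ : ∀ {k} (i : Fin k) (f : Fin k → A) → Σ (λ j → f j * δ j i) ≡ f i
  Σ-δʳ i f = trans (Σ-cong (λ j → trans (*-comm _ _) (cong (_* f j) (δ-sym j i)))) (Σ-δˡ i f)

  Σ-splitAt : ∀ e {r} (f : Fin (e +ℕ r) → A) → Σ f ≡ Σ (λ a → f (a ↑ˡ r)) + Σ (λ i → f (e ↑ʳ i))
  Σ-splitAt zero f = sym (trans (cong (_+ Σ f) (Σ-empty _)) (+-identityˡ _))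
  Σ-splitAt (suc e) {r} f = begin
    Σ f ≡⟨ Σ-suc f ⟩
    f zero + Σ (λ j → f (suc j)) ≡⟨ cong (_+_ (f zero)) (Σ-splitAt e (λ j → f (suc j))) ⟩
    f zero + (Σ (λ a → f (suc (a ↑ˡ r))) + Σ (λ i → f (suc (e ↑ʳ i)))) ≡⟨ sym (+-assoc _ _ _) ⟩
    (f zero + Σ (λ a → f (suc (a ↑ˡ r)))) + Σ (λ i → f (suc e ↑ʳ i)) ≡⟨ cong (_+ _) (sym (Σ-suc _)) ⟩
    Σ (λ a → f (a ↑ˡ r)) + Σ (λ i → f (suc e ↑ʳ i)) ∎

  dot : ∀ {n} → (Fin n → A) → (Fin n → A) → A
  dot x y = Σ (λ i → x i * y i)

  dot-comm : ∀ {n} (x y : Fin n → A) → dot x y ≡ dot y x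
  dot-comm x y = Σ-cong (λ i → *-comm (x i) (y i))

  dot-combinationˡ : ∀ {k n} {x : Fin n → A} (c : Fin k → A) (G : Fin k → Fin n → A) →
    (∀ i → x i ≡ Σ (λ j → c j * G j i)) → ∀ y → dot x y ≡ Σ (λ j → c j * dot (G j) y)
  dot-combinationˡ {x = x} c G x≡ y = begin
    Σ (λ i → x i * y i) ≡⟨ Σ-cong (λ i → trans (cong (_* y i) (x≡ i)) (*-distribʳ-Σ (y i) _)) ⟩
    Σ (λ i → Σ (λ j → c j * G j i * y i)) ≡⟨ Σ-comm _ ⟩
    Σ (λ j → Σ (λ i → c j * G j i * y i)) ≡⟨ Σ-cong (λ j → Σ-cong (λ i → *-assoc _ _ _)) ⟩
    Σ (λ j → Σ (λ i → c j * (G j i * y i))) ≡⟨ Σ-cong (λ j → sym (*-distribˡ-Σ (c j) _)) ⟩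
    Σ (λ j → c j * dot (G j) y) ∎

  dot-Σˡ : ∀ {k n} (X : Fin k → Fin n → A) (y : Fin n → A) →
    dot (λ i → Σ (λ l → X l i)) y ≡ Σ (λ l → dot (X l) y)
  dot-Σˡ X y = trans (Σ-cong (λ i → *-distribʳ-Σ (y i) _)) (Σ-comm _)

  dot-subˡ : ∀ {n} (a b y : Fin n → A) → dot (λ i → a i - b i) y ≡ dot a y - dot b y
  dot-subˡ a b y = begin
    Σ (λ i → (a i - b i) * y i) ≡⟨ Σ-cong (λ i → trans (distribʳ (y i) (a i) (- b i))
                                      (cong (_+_ (a i * y i)) (sym (-‿distribˡ-* (b i) (y i))))) ⟩
    Σ (λ i → a i * y i + - (b i * y i)) ≡⟨ Σ-distrib-+ _ _ ⟩
    dot a y + Σ (λ i → - (b i * y i)) ≡⟨ cong (_+_ (dot a y)) (Σ-neg _) ⟩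
    dot a y - dot b y ∎

  infix 4 _≐_
  infixl 6 _⊞_
  infixl 7 _⊙_ _▷_
  infix 8 ⊟_

  Mat : ℕ → ℕ → Set
  Mat a b = Fin a → Fin b → A

  _⊙_ : ∀ {a b c} → Mat a b → Mat b c → Mat a c
  (M ⊙ N) i k = Σ (λ j → M i j * N j k)

  _▷_ : ∀ {a b} → Mat a b → (Fin b → A) → Fin a → A
  (M ▷ x) i = dot (M i) x

  _≐_ : ∀ {a b} → Mat a b → Mat a b → Set
  M ≐ N = ∀ i j → M i j ≡ N i j

  _⊞_ : ∀ {a b} → Mat a b → Mat a b → Mat a b
  (M ⊞ N) i j = M i j + N i j

  ⊟_ : ∀ {a b} → Mat a b → Mat a b
  (⊟ M) i j = - M i j

  𝟘 : ∀ {a b} → Mat a b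
  𝟘 i j = 0#

  ≐-trans : ∀ {a b} {M N P : Mat a b} → M ≐ N → N ≐ P → M ≐ P
  ≐-trans p q i j = trans (p i j) (q i j)

  ≐-sym : ∀ {a b} {M N : Mat a b} → M ≐ N → N ≐ M
  ≐-sym p i j = sym (p i j)

  ⊙-assoc : ∀ {a b c d} (M : Mat a b) (N : Mat b c) (P : Mat c d) → (M ⊙ N) ⊙ P ≐ M ⊙ (N ⊙ P)
  ⊙-assoc M N P i l = begin
    Σ (λ k → Σ (λ j → M i j * N j k) * P k l) ≡⟨ Σ-cong (λ k → *-distribʳ-Σ (P k l) _) ⟩
    Σ (λ k → Σ (λ j → M i j * N j k * P k l)) ≡⟨ Σ-comm _ ⟩
    Σ (λ j → Σ (λ k → M i j * N j k * P k l)) ≡⟨ Σ-cong (λ j → Σ-cong (λ k → *-assoc _ _ _)) ⟩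
    Σ (λ j → Σ (λ k → M i j * (N j k * P k l))) ≡⟨ Σ-cong (λ j → sym (*-distribˡ-Σ (M i j) _)) ⟩
    Σ (λ j → M i j * Σ (λ k → N j k * P k l)) ∎

  ▷-▷ : ∀ {a b c} (M : Mat a b) (N : Mat b c) (x : Fin c → A) i → (M ▷ (N ▷ x)) i ≡ ((M ⊙ N) ▷ x) i
  ▷-▷ M N x i = sym (⊙-assoc M N (λ j (_ : Fin 1) → x j) i zero)

  ▷-cancel : ∀ {a b} (M : Mat a b) (N : Mat b a) → M ⊙ N ≐ δ → ∀ x i → (M ▷ (N ▷ x)) i ≡ x i
  ▷-cancel M N MN≐δ x i = trans (▷-▷ M N x i) (trans (Σ-cong (λ j → cong (_* x j) (MN≐δ i j))) (Σ-δˡ i x))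

  ▷-combination : ∀ {a b k} (M : Mat a b) {y : Fin b → A} (c : Fin k → A) (Y : Fin k → Fin b → A) →
    (∀ t → y t ≡ Σ (λ j → c j * Y j t)) → ∀ i → (M ▷ y) i ≡ Σ (λ j → c j * (M ▷ Y j) i)
  ▷-combination M {y} c Y y≡ i = trans (dot-comm (M i) y)
    (trans (dot-combinationˡ c Y y≡ (M i)) (Σ-cong (λ j → cong (c j *_) (dot-comm (Y j) (M i)))))

  ▷-Σ : ∀ {a b k} (M : Mat a b) {y : Fin b → A} (X : Fin k → Fin b → A) →
    (∀ t → y t ≡ Σ (λ j → X j t)) → ∀ i → (M ▷ y) i ≡ Σ (λ j → (M ▷ X j) i)
  ▷-Σ M {y} X y≡ i = trans (dot-comm (M i) y) (trans (Σ-cong (λ t → cong (_* M i t) (y≡ t)))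
    (trans (dot-Σˡ X (M i)) (Σ-cong (λ j → dot-comm (X j) (M i)))))

  ▷-cong : ∀ {a b} (M : Mat a b) {x y : Fin b → A} → (∀ t → x t ≡ y t) → ∀ i → (M ▷ x) i ≡ (M ▷ y) i
  ▷-cong M x≗y i = Σ-cong (λ t → cong (M i t *_) (x≗y t))

  ⊙-congˡ : ∀ {a b c} {M M′ : Mat a b} (N : Mat b c) → M ≐ M′ → M ⊙ N ≐ M′ ⊙ N
  ⊙-congˡ N p i k = Σ-cong (λ j → cong (_* N j k) (p i j))

  ⊙-congʳ : ∀ {a b c} (M : Mat a b) {N N′ : Mat b c} → N ≐ N′ → M ⊙ N ≐ M ⊙ N′
  ⊙-congʳ M p i k = Σ-cong (λ j → cong (M i j *_) (p j k))

  ⊙-identityˡ : ∀ {a b} (M : Mat a b) → δ ⊙ M ≐ M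
  ⊙-identityˡ M i k = Σ-δˡ i (λ j → M j k)

  ⊙-identityʳ : ∀ {a b} (M : Mat a b) → M ⊙ δ ≐ M
  ⊙-identityʳ M i k = Σ-δʳ k (M i)

  ⊙-distribˡ-⊞ : ∀ {a b c} (M : Mat a b) (N P : Mat b c) → M ⊙ (N ⊞ P) ≐ M ⊙ N ⊞ M ⊙ P
  ⊙-distribˡ-⊞ M N P i k = trans (Σ-cong (λ j → distribˡ (M i j) (N j k) (P j k))) (Σ-distrib-+ _ _)

  ⊙-distribʳ-⊞ : ∀ {a b c} (M N : Mat a b) (P : Mat b c) → (M ⊞ N) ⊙ P ≐ M ⊙ P ⊞ N ⊙ P
  ⊙-distribʳ-⊞ M N P i k = trans (Σ-cong (λ j → distribʳ (P j k) (M i j) (N i j))) (Σ-distrib-+ _ _)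

  ⊙-negˡ : ∀ {a b c} (M : Mat a b) (N : Mat b c) → (⊟ M) ⊙ N ≐ ⊟ (M ⊙ N)
  ⊙-negˡ M N i k = trans (Σ-cong (λ j → sym (-‿distribˡ-* (M i j) (N j k)))) (Σ-neg _)

  ⊙-negʳ : ∀ {a b c} (M : Mat a b) (N : Mat b c) → M ⊙ (⊟ N) ≐ ⊟ (M ⊙ N)
  ⊙-negʳ M N i k = trans (Σ-cong (λ j → sym (-‿distribʳ-* (M i j) (N j k)))) (Σ-neg _)

  ⊙-zeroˡ : ∀ {a b c} {M : Mat a b} (N : Mat b c) → M ≐ 𝟘 → M ⊙ N ≐ 𝟘
  ⊙-zeroˡ N p i k = Σ-zero (λ j → trans (cong (_* N j k) (p i j)) (zeroˡ (N j k)))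

  ⊙-zeroʳ : ∀ {a b c} (M : Mat a b) {N : Mat b c} → N ≐ 𝟘 → M ⊙ N ≐ 𝟘
  ⊙-zeroʳ M p i k = Σ-zero (λ j → trans (cong (M i j *_) (p j k)) (zeroʳ (M i j)))

  ⊙-cancel-inner : ∀ {a b c d} (M : Mat a b) (N : Mat b c) (P : Mat c b) (Q : Mat b d) →
    N ⊙ P ≐ δ → (M ⊙ N) ⊙ (P ⊙ Q) ≐ M ⊙ Q
  ⊙-cancel-inner M N P Q NP≐δ = ≐-trans (⊙-assoc M N (P ⊙ Q))
    (⊙-congʳ M (≐-trans (≐-sym (⊙-assoc N P Q)) (≐-trans (⊙-congˡ Q NP≐δ) (⊙-identityˡ Q))))

module OrderedRingSums {A : Set} {add mul : A → A → A} {neg : A → A} {zero# one# : A}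
  (isCommutativeRing : IsCommutativeRing _≡_ add mul neg zero# one#)
  (Σ : ∀ {k} → (Fin k → A) → A)
  (Σ-empty : (f : Fin 0 → A) → Σ f ≡ zero#)
  (Σ-suc : ∀ {k} (f : Fin (suc k) → A) → Σ f ≡ add (f zero) (Σ (λ j → f (suc j))))
  (leq : A → A → Set)
  (≤-refl : ∀ {a} → leq a a)
  (≤-antisym : ∀ {a b} → leq a b → leq b a → a ≡ b)
  (+-mono-≤ : ∀ {a b c d} → leq a b → leq c d → leq (add a c) (add b d))
  (*-nonneg : ∀ {a b} → leq zero# a → leq zero# b → leq zero# (mul a b)) where

  ring : CommutativeRing _ _
  ring = record { isCommutativeRing = isCommutativeRing }

  open CommutativeRing ring
    using (_+_; _*_; -_; 0#; 1#; +-assoc; +-comm; +-identityˡ; +-identityʳ; distribˡ; *-identityʳ; -‿inverseʳ)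
  open import Algebra.Properties.Ring (CommutativeRing.ring ring) using (-‿distribʳ-*)

  infix 4 _≤_
  _≤_ : A → A → Set
  _≤_ = leq

  0≤+ : ∀ {a b} → 0# ≤ a → 0# ≤ b → 0# ≤ a + b
  0≤+ p q = subst (_≤ _) (+-identityˡ 0#) (+-mono-≤ p q)

  a≤a+b : ∀ {a b} → 0# ≤ b → a ≤ a + b
  a≤a+b {a} {b} p = subst (_≤ a + b) (+-identityʳ a) (+-mono-≤ (≤-refl {a}) p)

  Σ-nonneg : ∀ {k} {f : Fin k → A} → (∀ i → 0# ≤ f i) → 0# ≤ Σ f
  Σ-nonneg {zero} {f} p = subst (0# ≤_) (sym (Σ-empty f)) ≤-refl
  Σ-nonneg {suc k} {f} p = subst (0# ≤_) (sym (Σ-suc f)) (0≤+ (p zero) (Σ-nonneg (λ i → p (suc i))))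

  Σ-mono-≤ : ∀ {k} {f g : Fin k → A} → (∀ i → f i ≤ g i) → Σ f ≤ Σ g
  Σ-mono-≤ {zero} {f} {g} p = subst₂ _≤_ (sym (Σ-empty f)) (sym (Σ-empty g)) ≤-refl
  Σ-mono-≤ {suc k} {f} {g} p =
    subst₂ _≤_ (sym (Σ-suc f)) (sym (Σ-suc g)) (+-mono-≤ (p zero) (Σ-mono-≤ (λ i → p (suc i))))

  term≤Σ : ∀ {k} {f : Fin k → A} → (∀ i → 0# ≤ f i) → ∀ i → f i ≤ Σ f
  term≤Σ {suc k} {f} p zero = subst (_ ≤_) (sym (Σ-suc f)) (a≤a+b (Σ-nonneg (λ i → p (suc i))))
  term≤Σ {suc k} {f} p (suc i) =
    subst₂ _≤_ (+-identityˡ _) (sym (Σ-suc f)) (+-mono-≤ (p zero) (term≤Σ (λ j → p (suc j)) i))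

  Σ-nonneg≡0 : ∀ {k} {f : Fin k → A} → (∀ i → 0# ≤ f i) → Σ f ≡ 0# → ∀ i → f i ≡ 0#
  Σ-nonneg≡0 p Σ≡0 i = ≤-antisym (subst (_ ≤_) Σ≡0 (term≤Σ p i)) (p i)

  ≤⇒0≤- : ∀ {a b} → a ≤ b → 0# ≤ b + - a
  ≤⇒0≤- {a} {b} p = subst (_≤ b + - a) (-‿inverseʳ a) (+-mono-≤ p (≤-refl { - a}))

  0≤-⇒≤ : ∀ {a b} → 0# ≤ b + - a → a ≤ b
  0≤-⇒≤ {a} {b} p = subst₂ _≤_ (+-identityʳ a) a+[b-a]≡b (+-mono-≤ (≤-refl {a}) p)
    where
    a+[b-a]≡b : a + (b + - a) ≡ b
    a+[b-a]≡b = begin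
      a + (b + - a) ≡⟨ cong (_+_ a) (+-comm b (- a)) ⟩
      a + (- a + b) ≡⟨ sym (+-assoc a (- a) b) ⟩
      (a + - a) + b ≡⟨ cong (_+ b) (-‿inverseʳ a) ⟩
      0# + b ≡⟨ +-identityˡ b ⟩
      b ∎

  a≤a*b : ∀ {c h} → 0# ≤ c → 1# ≤ h → c ≤ c * h
  a≤a*b {c} {h} 0≤c 1≤h = 0≤-⇒≤ (subst (0# ≤_) c[h-1]≡ch-c (*-nonneg 0≤c (≤⇒0≤- 1≤h)))
    where
    c[h-1]≡ch-c : c * (h + - 1#) ≡ c * h + - c
    c[h-1]≡ch-c = trans (distribˡ c h (- 1#))
      (cong (_+_ (c * h)) (trans (sym (-‿distribʳ-* c 1#)) (cong -_ (*-identityʳ c))))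

-- The integers inside the rationals

unit-diag : ∀ {n} (i : Fin n) → unit i i ≡ + 1
unit-diag i with i Fin.≟ i
... | yes _ = refl
... | no i≢i = ⊥-elim (i≢i refl)

unit-offdiag : ∀ {n} {i j : Fin n} → ¬ i ≡ j → unit i j ≡ + 0
unit-offdiag {i = i} {j} i≢j with i Fin.≟ j
... | yes i≡j = ⊥-elim (i≢j i≡j)
... | no _ = refl

unit-nonneg : ∀ {n} (i j : Fin n) → + 0 ℤ.≤ unit i j
unit-nonneg i j with i Fin.≟ j
... | yes _ = ℤ.+≤+ z≤n
... | no _ = ℤ.+≤+ z≤n

module Z = RingSums ℤP.+-*-isCommutativeRing sumℤ (λ _ → refl) (λ _ → refl) unit unit-diag unit-offdiag

ι : ℤ → ℚ
ι x = x ℚ./ 1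

ι≡mkℚ : ∀ x → ι x ≡ mkℚ x 0 (coprime-sym (1-coprimeTo ℤ.∣ x ∣))
ι≡mkℚ (+ n) = ℚP.normalize-coprime (coprime-sym (1-coprimeTo n))
ι≡mkℚ -[1+ n ] = cong ℚ.-_ (ℚP.normalize-coprime (coprime-sym (1-coprimeTo (suc n))))

ι-+ : ∀ a b → ι (a ℤ.+ b) ≡ ι a ℚ.+ ι b
ι-+ a b rewrite ι≡mkℚ a | ι≡mkℚ b = cong (ℚ._/ 1) (a+b≡a1+b1 a b)
  where
  a+b≡a1+b1 : ∀ a b → a ℤ.+ b ≡ a ℤ.* + 1 ℤ.+ b ℤ.* + 1
  a+b≡a1+b1 = solve-∀

ι-* : ∀ a b → ι (a ℤ.* b) ≡ ι a ℚ.* ι b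
ι-* a b rewrite ι≡mkℚ a | ι≡mkℚ b = refl

ι-injective : ∀ {a b} → ι a ≡ ι b → a ≡ b
ι-injective {a} {b} eq = cong ℚ.numerator (trans (sym (ι≡mkℚ a)) (trans eq (ι≡mkℚ b)))

ι-mono-≤ : ∀ {a b} → a ℤ.≤ b → ι a ℚ.≤ ι b
ι-mono-≤ {a} {b} a≤b rewrite ι≡mkℚ a | ι≡mkℚ b =
  ℚ.*≤* (subst₂ ℤ._≤_ (sym (ℤP.*-identityʳ a)) (sym (ℤP.*-identityʳ b)) a≤b)

ι-cancel-≤ : ∀ {a b} → ι a ℚ.≤ ι b → a ℤ.≤ b
ι-cancel-≤ {a} {b} ιa≤ιb rewrite ι≡mkℚ a | ι≡mkℚ b with ιa≤ιb
... | ℚ.*≤* a1≤b1 = subst₂ ℤ._≤_ (ℤP.*-identityʳ a) (ℤP.*-identityʳ b) a1≤b1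

δℚ : ∀ {n} → Fin n → Fin n → ℚ
δℚ i j = ι (unit i j)

module Q = RingSums ℚP.+-*-isCommutativeRing sumℚ (λ _ → refl) (λ _ → refl)
  δℚ (λ i → cong ι (unit-diag i)) (λ i≢j → cong ι (unit-offdiag i≢j))

ι-Σ : ∀ {k} (f : Fin k → ℤ) → ι (sumℤ f) ≡ sumℚ (λ i → ι (f i))
ι-Σ {zero} f = refl
ι-Σ {suc k} f = trans (ι-+ (f zero) _) (cong (ι (f zero) ℚ.+_) (ι-Σ (λ i → f (suc i))))

ι-dot : ∀ {d} (a b : Vecℤ d) → ι (dotℤ a b) ≡ dotℚ (toℚ a) (toℚ b)
ι-dot a b = trans (ι-Σ (λ i → a i ℤ.* b i)) (Q.Σ-cong (λ i → ι-* (a i) (b i)))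

ιMat : ∀ {a b} → Z.Mat a b → Q.Mat a b
ιMat M s t = ι (M s t)

ι-⊙≐δ : ∀ {a b} (M : Z.Mat a b) (N : Z.Mat b a) → M Z.⊙ N Z.≐ unit → ιMat M Q.⊙ ιMat N Q.≐ δℚ
ι-⊙≐δ M N MN≐δ i j =
  trans (sym (trans (ι-Σ (λ t → M i t ℤ.* N t j)) (Q.Σ-cong (λ t → ι-* (M i t) (N t j))))) (cong ι (MN≐δ i j))

*-nonnegℤ : ∀ {a b} → + 0 ℤ.≤ a → + 0 ℤ.≤ b → + 0 ℤ.≤ a ℤ.* b
*-nonnegℤ {+ m} {+ n} _ _ = subst (+ 0 ℤ.≤_) (ℤP.pos-* m n) (ℤ.+≤+ z≤n)

*-nonnegℚ : ∀ {a b} → 0ℚ ℚ.≤ a → 0ℚ ℚ.≤ b → 0ℚ ℚ.≤ a ℚ.* b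
*-nonnegℚ {a} {b} 0≤a 0≤b =
  ℚP.nonNegative⁻¹ _ {{ℚP.nonNeg*nonNeg⇒nonNeg a {{ℚ.nonNegative 0≤a}} b {{ℚ.nonNegative 0≤b}}}}

module ZO = OrderedRingSums ℤP.+-*-isCommutativeRing sumℤ (λ _ → refl) (λ _ → refl)
  ℤ._≤_ ℤP.≤-refl ℤP.≤-antisym ℤP.+-mono-≤ *-nonnegℤ

module QO = OrderedRingSums ℚP.+-*-isCommutativeRing sumℚ (λ _ → refl) (λ _ → refl)
  ℚ._≤_ ℚP.≤-refl ℚP.≤-antisym ℚP.+-mono-≤ *-nonnegℚ

Σ-const-1 : ∀ r → sumℤ {r} (λ _ → + 1) ≡ + r
Σ-const-1 zero = refl
Σ-const-1 (suc r) = cong (ℤ._+_ (+ 1)) (Σ-const-1 r)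

Σ-unit : ∀ {r} (i : Fin r) → sumℤ (unit i) ≡ + 1
Σ-unit i = trans (Z.Σ-cong (λ j → sym (ℤP.*-identityʳ (unit i j)))) (Z.Σ-δˡ i (λ _ → + 1))

Σ-minus : ∀ {r} (f g : Fin r → ℤ) → sumℤ (λ i → f i Z.- g i) ≡ sumℤ f Z.- sumℤ g
Σ-minus f g = trans (Z.Σ-distrib-+ f _) (cong (sumℤ f Z.+_) (Z.Σ-neg g))

all≥1∧Σ≡r⇒all≡1 : ∀ {r} (f : Fin r → ℤ) → (∀ i → + 1 ℤ.≤ f i) → sumℤ f ≡ + r → ∀ i → f i ≡ + 1
all≥1∧Σ≡r⇒all≡1 {r} f 1≤f Σf≡r i =
  Z.x∙y⁻¹≈ε⇒x≈y (f i) (+ 1) (ZO.Σ-nonneg≡0 (λ j → ZO.≤⇒0≤- (1≤f j)) Σ[f-1]≡0 i)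
  where
  Σ[f-1]≡0 : sumℤ (λ j → f j Z.- + 1) ≡ + 0
  Σ[f-1]≡0 = begin
    sumℤ (λ j → f j Z.- + 1) ≡⟨ Σ-minus f (λ _ → + 1) ⟩
    sumℤ f Z.- sumℤ {r} (λ _ → + 1) ≡⟨ cong₂ Z._-_ Σf≡r (Σ-const-1 r) ⟩
    + r Z.- + r ≡⟨ ℤP.+-inverseʳ (+ r) ⟩
    + 0 ∎

nonneg∧Σ≡1⇒≡unit : ∀ {r} (f : Fin r → ℤ) → (∀ t → + 0 ℤ.≤ f t) → sumℤ f ≡ + 1 →
  ∀ i → f i ≡ + 1 → ∀ t → f t ≡ unit i t
nonneg∧Σ≡1⇒≡unit {r} f 0≤f Σf≡1 i fi≡1 t =
  Z.x∙y⁻¹≈ε⇒x≈y (f t) (unit i t) (ZO.Σ-nonneg≡0 0≤f-unit Σ[f-unit]≡0 t)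
  where
  0≤f-unit : ∀ t → + 0 ℤ.≤ f t Z.- unit i t
  0≤f-unit t with i Fin.≟ t
  ... | yes refl = ℤP.≤-reflexive (sym (cong (Z._- + 1) fi≡1))
  ... | no _ = subst (+ 0 ℤ.≤_) (sym (ℤP.+-identityʳ (f t))) (0≤f t)
  Σ[f-unit]≡0 : sumℤ (λ t → f t Z.- unit i t) ≡ + 0
  Σ[f-unit]≡0 = trans (Σ-minus f (unit i)) (cong₂ Z._-_ Σf≡1 (Σ-unit i))

nonneg∧Σ≡1⇒0or1 : ∀ {r} (f : Fin r → ℤ) → (∀ t → + 0 ℤ.≤ f t) → sumℤ f ≡ + 1 →
  ∀ i → f i ≡ + 0 ⊎ f i ≡ + 1
nonneg∧Σ≡1⇒0or1 f 0≤f Σf≡1 i = between0and1 (f i) (0≤f i) (subst (f i ℤ.≤_) Σf≡1 (ZO.term≤Σ 0≤f i))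
  where
  between0and1 : ∀ a → + 0 ℤ.≤ a → a ℤ.≤ + 1 → a ≡ + 0 ⊎ a ≡ + 1
  between0and1 (+ zero) _ _ = inj₁ refl
  between0and1 (+ suc zero) _ _ = inj₂ refl
  between0and1 (+ suc (suc n)) _ (ℤ.+≤+ (s≤s ()))

nonneg∧≢0⇒≥1 : ∀ a → + 0 ℤ.≤ a → ¬ a ≡ + 0 → + 1 ℤ.≤ a
nonneg∧≢0⇒≥1 (+ zero) _ a≢0 = ⊥-elim (a≢0 refl)
nonneg∧≢0⇒≥1 (+ suc n) _ _ = ℤ.+≤+ (s≤s z≤n)

module _ {d k : ℕ} (G : Fin k → Vecℚ d) where

  InCone-resp-≗ : ∀ {x y} → InCone G x → (∀ i → x i ≡ y i) → InCone G y
  InCone-resp-≗ (c , 0≤c , x≡) x≗y = c , 0≤c , (λ i → trans (sym (x≗y i)) (x≡ i))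

  InCone-0 : InCone G (λ _ → 0ℚ)
  InCone-0 = (λ _ → 0ℚ) , (λ _ → ℚP.≤-refl) , (λ i → sym (Q.Σ-zero (λ j → ℚP.*-zeroˡ (G j i))))

  InCone-generator : ∀ j → InCone G (G j)
  InCone-generator j = δℚ j , (λ l → ι-mono-≤ (unit-nonneg j l)) , (λ i → sym (Q.Σ-δˡ j (λ l → G l i)))

  InCone-+ : ∀ {x y} → InCone G x → InCone G y → InCone G (λ i → x i ℚ.+ y i)
  InCone-+ {x} {y} (c , 0≤c , x≡) (c′ , 0≤c′ , y≡) =
    (λ j → c j ℚ.+ c′ j) , (λ j → QO.0≤+ (0≤c j) (0≤c′ j)) , λ i → begin
      x i ℚ.+ y i ≡⟨ cong₂ ℚ._+_ (x≡ i) (y≡ i) ⟩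
      sumℚ (λ j → c j ℚ.* G j i) ℚ.+ sumℚ (λ j → c′ j ℚ.* G j i)
        ≡⟨ sym (Q.Σ-distrib-+ (λ j → c j ℚ.* G j i) (λ j → c′ j ℚ.* G j i)) ⟩
      sumℚ (λ j → c j ℚ.* G j i ℚ.+ c′ j ℚ.* G j i)
        ≡⟨ Q.Σ-cong (λ j → sym (Q.distribʳ (G j i) (c j) (c′ j))) ⟩
      sumℚ (λ j → (c j ℚ.+ c′ j) ℚ.* G j i) ∎

  InCone-scale : ∀ {x} (a : ℚ) → 0ℚ ℚ.≤ a → InCone G x → InCone G (λ i → a ℚ.* x i)
  InCone-scale {x} a 0≤a (c , 0≤c , x≡) = (λ j → a ℚ.* c j) , (λ j → *-nonnegℚ 0≤a (0≤c j)) , λ i → begin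
    a ℚ.* x i ≡⟨ cong (a ℚ.*_) (x≡ i) ⟩
    a ℚ.* sumℚ (λ j → c j ℚ.* G j i) ≡⟨ Q.*-distribˡ-Σ a (λ j → c j ℚ.* G j i) ⟩
    sumℚ (λ j → a ℚ.* (c j ℚ.* G j i)) ≡⟨ Q.Σ-cong (λ j → sym (Q.*-assoc a (c j) (G j i))) ⟩
    sumℚ (λ j → a ℚ.* c j ℚ.* G j i) ∎

  InCone-Σ : ∀ {l} (X : Fin l → Vecℚ d) → (∀ m → InCone G (X m)) → InCone G (λ i → sumℚ (λ m → X m i))
  InCone-Σ {zero} X _ = InCone-0
  InCone-Σ {suc l} X X∈ = InCone-+ (X∈ zero) (InCone-Σ (λ m → X (suc m)) (λ m → X∈ (suc m)))

module Gorenstein {d : ℕ} {C : Vecℚ d → Set} {w : Vecℤ d} (G : IsGorenstein C w) where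

  k : ℕ
  k = proj₁ G

  gen : Fin k → Vecℤ d
  gen = proj₁ (proj₂ G)

  ⟨gen,w⟩≡1 : ∀ j → dotℤ (gen j) w ≡ + 1
  ⟨gen,w⟩≡1 = proj₁ (proj₂ (proj₂ G))

  Gen : Fin k → Vecℚ d
  Gen j = toℚ (gen j)

  toCone : ∀ {x} → C x → InCone Gen x
  toCone {x} = proj₁ (proj₁ (proj₂ (proj₂ (proj₂ G))) x)

  fromCone : ∀ {x} → InCone Gen x → C x
  fromCone {x} = proj₂ (proj₁ (proj₂ (proj₂ (proj₂ G))) x)

  C-gen : ∀ j → C (Gen j)
  C-gen j = fromCone (InCone-generator Gen j)

  C-resp-≗ : ∀ {x y} → C x → (∀ i → x i ≡ y i) → C y
  C-resp-≗ x∈C x≗y = fromCone (InCone-resp-≗ Gen (toCone x∈C) x≗y)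

  C-Σ : ∀ {l} (X : Fin l → Vecℚ d) → (∀ m → C (X m)) → C (λ i → sumℚ (λ m → X m i))
  C-Σ X X∈C = fromCone (InCone-Σ Gen X (λ m → toCone (X∈C m)))

  C-scale : ∀ {x} (a : ℚ) → 0ℚ ℚ.≤ a → C x → C (λ i → a ℚ.* x i)
  C-scale a 0≤a x∈C = fromCone (InCone-scale Gen a 0≤a (toCone x∈C))

  ⟨gen,u⟩ℚ : ∀ j (u : Vecℤ d) → dotℚ (Gen j) (toℚ u) ≡ ι (dotℤ (gen j) u)
  ⟨gen,u⟩ℚ j u = sym (ι-dot (gen j) u)

  coeff : ∀ {x} → C x → Fin k → ℚ
  coeff x∈C = proj₁ (toCone x∈C)

  dot-toCone : ∀ {x} (x∈C : C x) (y : Vecℚ d) →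
    dotℚ x y ≡ sumℚ (λ j → coeff x∈C j ℚ.* dotℚ (Gen j) y)
  dot-toCone x∈C = Q.dot-combinationˡ (coeff x∈C) Gen (proj₂ (proj₂ (toCone x∈C)))

  ⟨x,w⟩≡Σcoeff : ∀ {x} (x∈C : C x) → dotℚ x (toℚ w) ≡ sumℚ (coeff x∈C)
  ⟨x,w⟩≡Σcoeff x∈C = trans (dot-toCone x∈C (toℚ w)) (Q.Σ-cong λ j →
    trans (cong (coeff x∈C j ℚ.*_) (trans (⟨gen,u⟩ℚ j w) (cong ι (⟨gen,w⟩≡1 j)))) (ℚP.*-identityʳ (coeff x∈C j)))

  0≤⟨x,w⟩ : ∀ {x} → C x → 0ℚ ℚ.≤ dotℚ x (toℚ w)
  0≤⟨x,w⟩ x∈C = subst (0ℚ ℚ.≤_) (sym (⟨x,w⟩≡Σcoeff x∈C)) (QO.Σ-nonneg (proj₁ (proj₂ (toCone x∈C))))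

  ⟨x,w⟩≡0⇒x≡0 : ∀ {x} → C x → dotℚ x (toℚ w) ≡ 0ℚ → ∀ i → x i ≡ 0ℚ
  ⟨x,w⟩≡0⇒x≡0 x∈C ⟨x,w⟩≡0 i with toCone x∈C | ⟨x,w⟩≡Σcoeff x∈C
  ... | c , 0≤c , x≡ | ⟨x,w⟩≡Σc = trans (x≡ i) (Q.Σ-zero λ j →
    trans (cong (ℚ._* Gen j i) (QO.Σ-nonneg≡0 0≤c (trans (sym ⟨x,w⟩≡Σc) ⟨x,w⟩≡0) j)) (ℚP.*-zeroˡ (Gen j i)))

  nonzero⇒1≤⟨v,w⟩ : ∀ v → C (toℚ v) → ∀ t → ¬ v t ≡ + 0 → + 1 ℤ.≤ dotℤ v w
  nonzero⇒1≤⟨v,w⟩ v v∈C t vt≢0 = nonneg∧≢0⇒≥1 _ 0≤⟨v,w⟩ℤ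
      (λ ⟨v,w⟩≡0 → vt≢0 (ι-injective (⟨x,w⟩≡0⇒x≡0 v∈C (trans (sym (ι-dot v w)) (cong ι ⟨v,w⟩≡0)) t)))
    where
    0≤⟨v,w⟩ℤ : + 0 ℤ.≤ dotℤ v w
    0≤⟨v,w⟩ℤ = ι-cancel-≤ (subst (0ℚ ℚ.≤_) (sym (ι-dot v w)) (0≤⟨x,w⟩ v∈C))

  -- C spans, so a functional vanishing on C vanishes on every unit vector.
  vanishes-on-C⇒0 : (u : Vecℚ d) → (∀ x → C x → dotℚ x u ≡ 0ℚ) → ∀ t → u t ≡ 0ℚ
  vanishes-on-C⇒0 u u⊥C t with proj₂ (proj₂ (proj₂ (proj₂ G))) (toℚ (unit t))
  ... | a , b , a∈C , b∈C , eₜ≡a-b = begin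
    u t ≡⟨ sym (Q.Σ-δˡ t u) ⟩
    dotℚ (toℚ (unit t)) u ≡⟨ Q.Σ-cong (λ i → cong (ℚ._* u i) (eₜ≡a-b i)) ⟩
    dotℚ (λ i → a i ℚ.- b i) u ≡⟨ Q.dot-subˡ a b u ⟩
    dotℚ a u ℚ.- dotℚ b u ≡⟨ cong₂ ℚ._-_ (u⊥C a a∈C) (u⊥C b b∈C) ⟩
    0ℚ ∎

  agree-on-gens : (u v : Vecℤ d) → (∀ j → dotℤ (gen j) u ≡ dotℤ (gen j) v) → ∀ t → u t ≡ v t
  agree-on-gens u v u≗v t = Z.x∙y⁻¹≈ε⇒x≈y (u t) (v t)
    (ι-injective (vanishes-on-C⇒0 (toℚ u-v) u-v⊥C t))
    where
    u-v : Vecℤ d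
    u-v t = u t Z.- v t
    ⟨gen,u-v⟩≡0 : ∀ j → dotℤ (gen j) u-v ≡ + 0
    ⟨gen,u-v⟩≡0 j = begin
      dotℤ (gen j) u-v ≡⟨ Z.dot-comm (gen j) u-v ⟩
      dotℤ u-v (gen j) ≡⟨ Z.dot-subˡ u v (gen j) ⟩
      dotℤ u (gen j) Z.- dotℤ v (gen j) ≡⟨ cong₂ Z._-_ (Z.dot-comm u (gen j)) (Z.dot-comm v (gen j)) ⟩
      dotℤ (gen j) u Z.- dotℤ (gen j) v ≡⟨ cong (Z._- _) (u≗v j) ⟩
      dotℤ (gen j) v Z.- dotℤ (gen j) v ≡⟨ ℤP.+-inverseʳ (dotℤ (gen j) v) ⟩
      + 0 ∎
    u-v⊥C : ∀ x → C x → dotℚ x (toℚ u-v) ≡ 0ℚ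
    u-v⊥C x x∈C = trans (dot-toCone x∈C (toℚ u-v)) (Q.Σ-zero λ j →
      trans (cong (coeff x∈C j ℚ.*_) (trans (⟨gen,u⟩ℚ j u-v) (cong ι (⟨gen,u-v⟩≡0 j)))) (ℚP.*-zeroʳ (coeff x∈C j)))

-- Completing unimodular rows to a lattice basis

open Z using (Mat; _⊙_; _≐_; _⊞_; ⊟_; 𝟘; _-_; ≐-trans; ≐-sym)

record Annihilator₂ (x y : ℤ) : Set where
  field
    a b c d : ℤ
    det≡1 : a ℤ.* d - b ℤ.* c ≡ + 1
    annihilates : x ℤ.* b ℤ.+ y ℤ.* d ≡ + 0

-- Euclid's algorithm: from an annihilator of (y , q y - x) one of (x , y) is read off.
annihilator₂ : ∀ x y → Annihilator₂ x y
annihilator₂ x y = euclid (suc ℤ.∣ y ∣) x y (ℕP.n<1+n _)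
  where
  euclid : ∀ fuel x y → ℤ.∣ y ∣ ℕ.< fuel → Annihilator₂ x y
  euclid (suc fuel) x y ∣y∣<fuel with y ℤ.≟ + 0
  ... | yes refl = record { a = + 1 ; b = + 0 ; c = + 0 ; d = + 1 ; det≡1 = refl
                          ; annihilates = cong (ℤ._+ + 0) (ℤP.*-zeroʳ x) }
  ... | no y≢0 = record
    { a = ℤ.- c′ ; b = ℤ.- d′ ; c = a′ ℤ.+ q ℤ.* c′ ; d = b′ ℤ.+ q ℤ.* d′
    ; det≡1 = trans (det-identity a′ b′ c′ d′ q) det′≡1
    ; annihilates = trans (annihilates-identity x y b′ d′ q) annihilates′ }
    where
    instance
      _ : ℤ.NonZero y
      _ = ℤ.≢-nonZero y≢0
    q : ℤ
    q = x / y
    z : ℤ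
    z = q ℤ.* y - x
    z≡-rem : z ≡ ℤ.- (+ (x % y))
    z≡-rem = trans (cong (λ x → q ℤ.* y - x) (a≡a%n+[a/n]*n x y)) (cancel q y (+ (x % y)))
      where
      cancel : ∀ q y ρ → q ℤ.* y ℤ.+ ℤ.- (ρ ℤ.+ q ℤ.* y) ≡ ℤ.- ρ
      cancel = solve-∀
    ∣z∣<fuel : ℤ.∣ z ∣ ℕ.< fuel
    ∣z∣<fuel = subst (ℕ._< fuel) (sym (trans (cong ℤ.∣_∣ z≡-rem) (ℤP.∣-i∣≡∣i∣ (+ (x % y)))))
      (ℕP.<-≤-trans (n%d<d x y) (ℕP.≤-pred ∣y∣<fuel))
    open Annihilator₂ (euclid fuel y z ∣z∣<fuel)
      renaming (a to a′; b to b′; c to c′; d to d′; det≡1 to det′≡1; annihilates to annihilates′)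
    det-identity : ∀ a′ b′ c′ d′ q →
      (ℤ.- c′) ℤ.* (b′ ℤ.+ q ℤ.* d′) ℤ.+ ℤ.- ((ℤ.- d′) ℤ.* (a′ ℤ.+ q ℤ.* c′))
        ≡ a′ ℤ.* d′ ℤ.+ ℤ.- (b′ ℤ.* c′)
    det-identity = solve-∀
    annihilates-identity : ∀ x y b′ d′ q →
      x ℤ.* (ℤ.- d′) ℤ.+ y ℤ.* (b′ ℤ.+ q ℤ.* d′) ≡ y ℤ.* b′ ℤ.+ (q ℤ.* y ℤ.+ ℤ.- x) ℤ.* d′
    annihilates-identity = solve-∀

Σ-0* : ∀ {k} (f : Fin k → ℤ) → sumℤ (λ t → + 0 ℤ.* f t) ≡ + 0
Σ-0* f = Z.Σ-zero {f = λ t → + 0 ℤ.* f t} (λ t → refl)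

Σ-*0 : ∀ {k} (f : Fin k → ℤ) → sumℤ (λ t → f t ℤ.* + 0) ≡ + 0
Σ-*0 f = Z.Σ-zero (λ t → ℤP.*-zeroʳ (f t))

1⊕_ : ∀ {n} → Mat n n → Mat (suc n) (suc n)
(1⊕ U) zero zero = + 1
(1⊕ U) zero (suc j) = + 0
(1⊕ U) (suc i) zero = + 0
(1⊕ U) (suc i) (suc j) = U i j

1⊕-⊙ : ∀ {n} (U V : Mat n n) → (1⊕ U) ⊙ (1⊕ V) ≐ 1⊕ (U ⊙ V)
1⊕-⊙ {n} U V zero zero = cong (ℤ._+_ (+ 1)) (Σ-0* (λ (_ : Fin n) → + 0))
1⊕-⊙ U V zero (suc j) = cong (ℤ._+_ (+ 0)) (Σ-0* (λ t → V t j))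
1⊕-⊙ U V (suc i) zero = cong (ℤ._+_ (+ 0)) (Σ-*0 (U i))
1⊕-⊙ U V (suc i) (suc j) = ℤP.+-identityˡ _

1⊕-unit : ∀ {n} {M : Mat n n} → M ≐ unit → 1⊕ M ≐ unit
1⊕-unit M≐I zero zero = refl
1⊕-unit M≐I zero (suc j) = refl
1⊕-unit M≐I (suc i) zero = refl
1⊕-unit M≐I (suc i) (suc j) = trans (M≐I i j) (sym (Z.δ-suc i j))

1⊕-inverse : ∀ {n} {U V : Mat n n} → U ⊙ V ≐ unit → (1⊕ U) ⊙ (1⊕ V) ≐ unit
1⊕-inverse {U = U} {V} U⊙V≐I = ≐-trans (1⊕-⊙ U V) (1⊕-unit U⊙V≐I)

block₂ : ∀ {n} → ℤ → ℤ → ℤ → ℤ → Mat (suc (suc n)) (suc (suc n))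
block₂ a b c d zero zero = a
block₂ a b c d zero (suc zero) = b
block₂ a b c d (suc zero) zero = c
block₂ a b c d (suc zero) (suc zero) = d
block₂ a b c d zero (suc (suc j)) = + 0
block₂ a b c d (suc zero) (suc (suc j)) = + 0
block₂ a b c d (suc (suc i)) zero = + 0
block₂ a b c d (suc (suc i)) (suc zero) = + 0
block₂ a b c d (suc (suc i)) (suc (suc j)) = unit i j

block₂-inverse : ∀ {n} a b c d a′ b′ c′ d′ →
  a ℤ.* a′ ℤ.+ b ℤ.* c′ ≡ + 1 → a ℤ.* b′ ℤ.+ b ℤ.* d′ ≡ + 0 →
  c ℤ.* a′ ℤ.+ d ℤ.* c′ ≡ + 0 → c ℤ.* b′ ℤ.+ d ℤ.* d′ ≡ + 1 →
  block₂ {n} a b c d ⊙ block₂ a′ b′ c′ d′ ≐ unit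
block₂-inverse {n} a b c d a′ b′ c′ d′ e₀₀ e₀₁ e₁₀ e₁₁ = entry
  where
  corner : ∀ x y v → x ℤ.+ y ≡ v → x ℤ.+ (y ℤ.+ sumℤ {n} (λ _ → + 0 ℤ.* + 0)) ≡ v
  corner x y v eq = trans (cong (λ s → x ℤ.+ (y ℤ.+ s)) (Σ-0* (λ (_ : Fin n) → + 0)))
    (trans (cong (ℤ._+_ x) (ℤP.+-identityʳ y)) eq)
  border : ∀ x y j → x ℤ.* + 0 ℤ.+ (y ℤ.* + 0 ℤ.+ sumℤ (λ t → + 0 ℤ.* unit t j)) ≡ + 0
  border x y j = trans (cong₂ (λ u v → u ℤ.+ (v ℤ.+ _)) (ℤP.*-zeroʳ x) (ℤP.*-zeroʳ y))
    (trans (ℤP.+-identityˡ _) (trans (ℤP.+-identityˡ _) (Σ-0* (λ t → unit t j))))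
  entry : block₂ a b c d ⊙ block₂ a′ b′ c′ d′ ≐ unit
  entry zero zero = corner (a ℤ.* a′) (b ℤ.* c′) (+ 1) e₀₀
  entry zero (suc zero) = corner (a ℤ.* b′) (b ℤ.* d′) (+ 0) e₀₁
  entry (suc zero) zero = corner (c ℤ.* a′) (d ℤ.* c′) (+ 0) e₁₀
  entry (suc zero) (suc zero) = corner (c ℤ.* b′) (d ℤ.* d′) (+ 1) e₁₁
  entry zero (suc (suc j)) = border a b j
  entry (suc zero) (suc (suc j)) = border c d j
  entry (suc (suc i)) zero = trans (ℤP.+-identityˡ _) (trans (ℤP.+-identityˡ _) (Σ-*0 (unit i)))
  entry (suc (suc i)) (suc zero) = trans (ℤP.+-identityˡ _) (trans (ℤP.+-identityˡ _) (Σ-*0 (unit i)))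
  entry (suc (suc i)) (suc (suc j)) = trans (ℤP.+-identityˡ _) (trans (ℤP.+-identityˡ _)
    (trans (Z.⊙-identityˡ unit i j) (sym (trans (Z.δ-suc (suc i) (suc j)) (Z.δ-suc i j)))))

adjugate-inverse : ∀ {n} a b c d → a ℤ.* d - b ℤ.* c ≡ + 1 →
  (block₂ {n} a b c d ⊙ block₂ d (ℤ.- b) (ℤ.- c) a ≐ unit)
  × (block₂ {n} d (ℤ.- b) (ℤ.- c) a ⊙ block₂ a b c d ≐ unit)
adjugate-inverse a b c d det≡1 =
  block₂-inverse a b c d d (ℤ.- b) (ℤ.- c) a
    (trans (det₁ a b c d) det≡1) (zero₁ a b) (zero₂ c d) (trans (det₂ a b c d) det≡1) ,
  block₂-inverse d (ℤ.- b) (ℤ.- c) a a b c d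
    (trans (det₃ a b c d) det≡1) (zero₃ b d) (zero₄ a c) (trans (det₄ a b c d) det≡1)
  where
  det₁ : ∀ a b c d → a ℤ.* d ℤ.+ b ℤ.* (ℤ.- c) ≡ a ℤ.* d ℤ.+ ℤ.- (b ℤ.* c)
  det₁ = solve-∀
  det₂ : ∀ a b c d → c ℤ.* (ℤ.- b) ℤ.+ d ℤ.* a ≡ a ℤ.* d ℤ.+ ℤ.- (b ℤ.* c)
  det₂ = solve-∀
  det₃ : ∀ a b c d → d ℤ.* a ℤ.+ (ℤ.- b) ℤ.* c ≡ a ℤ.* d ℤ.+ ℤ.- (b ℤ.* c)
  det₃ = solve-∀
  det₄ : ∀ a b c d → ℤ.- c ℤ.* b ℤ.+ a ℤ.* d ≡ a ℤ.* d ℤ.+ ℤ.- (b ℤ.* c)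
  det₄ = solve-∀
  zero₁ : ∀ a b → a ℤ.* (ℤ.- b) ℤ.+ b ℤ.* a ≡ + 0
  zero₁ = solve-∀
  zero₂ : ∀ c d → c ℤ.* d ℤ.+ d ℤ.* (ℤ.- c) ≡ + 0
  zero₂ = solve-∀
  zero₃ : ∀ b d → d ℤ.* b ℤ.+ (ℤ.- b) ℤ.* d ≡ + 0
  zero₃ = solve-∀
  zero₄ : ∀ a c → ℤ.- c ℤ.* a ℤ.+ a ℤ.* c ≡ + 0
  zero₄ = solve-∀

inverse-⊙ : ∀ {n} (U₁ V₁ U₂ V₂ : Mat n n) → U₁ ⊙ V₁ ≐ unit → U₂ ⊙ V₂ ≐ unit →
  (U₁ ⊙ U₂) ⊙ (V₂ ⊙ V₁) ≐ unit
inverse-⊙ U₁ V₁ U₂ V₂ U₁V₁≐I U₂V₂≐I = ≐-trans (Z.⊙-cancel-inner U₁ U₂ V₂ V₁ U₂V₂≐I) U₁V₁≐I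

record ColumnReduction {d} (a : Vecℤ (suc d)) : Set where
  field
    U V : Mat (suc d) (suc d)
    U⊙V≐I : U ⊙ V ≐ unit
    V⊙U≐I : V ⊙ U ≐ unit
    aU-tail≡0 : ∀ c → sumℤ (λ j → a j ℤ.* U j (suc c)) ≡ + 0

  leading : ℤ
  leading = sumℤ (λ j → a j ℤ.* U j zero)

  a≡leading*V₀ : ∀ j → a j ≡ leading ℤ.* V zero j
  a≡leading*V₀ j = begin
    a j ≡⟨ sym (Z.Σ-δʳ j a) ⟩
    sumℤ (λ j′ → a j′ ℤ.* unit j′ j) ≡⟨ Z.Σ-cong (λ j′ → cong (a j′ ℤ.*_) (sym (U⊙V≐I j′ j))) ⟩
    (row ⊙ (U ⊙ V)) zero j ≡⟨ sym (Z.⊙-assoc row U V zero j) ⟩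
    leading ℤ.* V zero j ℤ.+ sumℤ (λ c → (row ⊙ U) zero (suc c) ℤ.* V (suc c) j)
      ≡⟨ cong (ℤ._+_ (leading ℤ.* V zero j)) (Z.Σ-zero (λ c → cong (ℤ._* V (suc c) j) (aU-tail≡0 c))) ⟩
    leading ℤ.* V zero j ℤ.+ + 0 ≡⟨ ℤP.+-identityʳ _ ⟩
    leading ℤ.* V zero j ∎
    where
    row : Mat 1 (suc d)
    row _ = a

-- Reduce the tail of a to its first entry, then clear that entry against a₀ by a 2 × 2 step.
columnReduction : ∀ d (a : Vecℤ (suc d)) → ColumnReduction a
columnReduction zero a = record
  { U = unit ; V = unit ; U⊙V≐I = Z.⊙-identityˡ unit ; V⊙U≐I = Z.⊙-identityˡ unit ; aU-tail≡0 = λ () }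
columnReduction (suc d) a = record
  { U = U₁ ⊙ U₂ ; V = V₂ ⊙ V₁
  ; U⊙V≐I = inverse-⊙ U₁ V₁ U₂ V₂ (1⊕-inverse U′⊙V′≐I) (proj₁ (adjugate-inverse α β γ δ det≡1))
  ; V⊙U≐I = inverse-⊙ V₂ U₂ V₁ U₁ (proj₂ (adjugate-inverse α β γ δ det≡1)) (1⊕-inverse V′⊙U′≐I)
  ; aU-tail≡0 = λ c → trans (sym (Z.⊙-assoc row U₁ U₂ zero (suc c))) (cleared c) }
  where
  open ColumnReduction (columnReduction d (λ j → a (suc j)))
    renaming (U to U′; V to V′; U⊙V≐I to U′⊙V′≐I; V⊙U≐I to V′⊙U′≐I; aU-tail≡0 to aU′-tail≡0)
  b : ℤ
  b = sumℤ (λ j → a (suc j) ℤ.* U′ j zero)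
  open Annihilator₂ (annihilator₂ (a zero) b)
    renaming (a to α; b to β; c to γ; d to δ)
  U₁ V₁ U₂ V₂ : Mat (suc (suc d)) (suc (suc d))
  U₁ = 1⊕ U′
  V₁ = 1⊕ V′
  U₂ = block₂ α β γ δ
  V₂ = block₂ δ (ℤ.- β) (ℤ.- γ) α
  row : Mat 1 (suc (suc d))
  row _ j = a j
  aU₁ : Fin (suc (suc d)) → ℤ
  aU₁ = (row ⊙ U₁) zero
  aU₁-zero : aU₁ zero ≡ a zero
  aU₁-zero = trans (cong (ℤ._+_ (a zero ℤ.* + 1)) (Σ-*0 (λ j → a (suc j))))
    (trans (ℤP.+-identityʳ _) (ℤP.*-identityʳ _))
  aU₁-suc : ∀ c → aU₁ (suc c) ≡ sumℤ (λ j → a (suc j) ℤ.* U′ j c)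
  aU₁-suc c = trans (cong (ℤ._+ sumℤ (λ j → a (suc j) ℤ.* U′ j c)) (ℤP.*-zeroʳ (a zero))) (ℤP.+-identityˡ _)
  cleared : ∀ c → (row ⊙ U₁ ⊙ U₂) zero (suc c) ≡ + 0
  cleared zero = begin
    aU₁ zero ℤ.* β ℤ.+ (aU₁ (suc zero) ℤ.* δ ℤ.+ sumℤ (λ t → aU₁ (suc (suc t)) ℤ.* + 0))
      ≡⟨ cong (λ z → aU₁ zero ℤ.* β ℤ.+ (aU₁ (suc zero) ℤ.* δ ℤ.+ z)) (Σ-*0 (λ t → aU₁ (suc (suc t)))) ⟩
    aU₁ zero ℤ.* β ℤ.+ (aU₁ (suc zero) ℤ.* δ ℤ.+ + 0)
      ≡⟨ cong₂ (λ u v → u ℤ.* β ℤ.+ v) aU₁-zero (trans (ℤP.+-identityʳ _) (cong (ℤ._* δ) (aU₁-suc zero))) ⟩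
    a zero ℤ.* β ℤ.+ b ℤ.* δ ≡⟨ annihilates ⟩
    + 0 ∎
  cleared (suc c) = begin
    aU₁ zero ℤ.* + 0 ℤ.+ (aU₁ (suc zero) ℤ.* + 0 ℤ.+ sumℤ (λ t → aU₁ (suc (suc t)) ℤ.* unit t c))
      ≡⟨ cong₂ (λ u v → u ℤ.+ (v ℤ.+ sumℤ (λ t → aU₁ (suc (suc t)) ℤ.* unit t c)))
           (ℤP.*-zeroʳ (aU₁ zero)) (ℤP.*-zeroʳ (aU₁ (suc zero))) ⟩
    + 0 ℤ.+ (+ 0 ℤ.+ sumℤ (λ t → aU₁ (suc (suc t)) ℤ.* unit t c))
      ≡⟨ trans (ℤP.+-identityˡ _) (trans (ℤP.+-identityˡ _) (Z.Σ-δʳ c (λ t → aU₁ (suc (suc t))))) ⟩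
    aU₁ (suc (suc c)) ≡⟨ trans (aU₁-suc (suc c)) (aU′-tail≡0 c) ⟩
    + 0 ∎

-- [ C ; E ] is unimodular with inverse [ K S ].
record Complement {d r} (E : Mat r d) : Set where
  field
    e : ℕ
    C : Mat e d
    K : Mat d e
    S : Mat d r
    C⊙K≐I : C ⊙ K ≐ unit
    E⊙K≐0 : E ⊙ K ≐ 𝟘
    C⊙S≐0 : C ⊙ S ≐ 𝟘
    E⊙S≐I : E ⊙ S ≐ unit
    K⊙C⊞S⊙E≐I : K ⊙ C ⊞ S ⊙ E ≐ unit

complement-empty : ∀ {d} (E : Mat 0 d) → Complement E
complement-empty {d} E = record
  { e = d ; C = unit ; K = unit ; S = λ _ () ; C⊙K≐I = Z.⊙-identityˡ unit ; E⊙K≐0 = λ ()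
  ; C⊙S≐0 = λ _ () ; E⊙S≐I = λ ()
  ; K⊙C⊞S⊙E≐I = λ j j′ → trans (ℤP.+-identityʳ _) (Z.⊙-identityˡ unit j j′) }

complement-row : ∀ {d} (a w : Vecℤ d) → dotℤ a w ≡ + 1 → Complement {d} {1} (λ _ → a)
complement-row {zero} a w ()
complement-row {suc d} a w ⟨a,w⟩≡1 = record
  { e = d ; C = λ c → V (suc c) ; K = λ j c → U j (suc c) ; S = S₁
  ; C⊙K≐I = λ c c′ → trans (V⊙U≐I (suc c) (suc c′)) (Z.δ-suc c c′)
  ; E⊙K≐0 = λ _ c → aU-tail≡0 c
  ; C⊙S≐0 = C⊙S≐0
  ; E⊙S≐I = λ { zero zero → trans (sym (Σ-U₀-u₀ a)) leading*u₀≡1 }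
  ; K⊙C⊞S⊙E≐I = K⊙C⊞S⊙E≐I }
  where
  cr : ColumnReduction a
  cr = columnReduction d a
  open ColumnReduction cr
  u₀ : ℤ
  u₀ = dotℤ (V zero) w
  S₁ : Mat (suc d) 1
  S₁ j _ = U j zero ℤ.* u₀
  Σ-U₀-u₀ : ∀ (x : Vecℤ (suc d)) → sumℤ (λ j → x j ℤ.* U j zero) ℤ.* u₀ ≡ sumℤ (λ j → x j ℤ.* S₁ j zero)
  Σ-U₀-u₀ x = trans (Z.*-distribʳ-Σ u₀ (λ j → x j ℤ.* U j zero))
    (Z.Σ-cong (λ j → ℤP.*-assoc (x j) (U j zero) u₀))
  leading*u₀≡1 : leading ℤ.* u₀ ≡ + 1
  leading*u₀≡1 = begin
    leading ℤ.* u₀ ≡⟨ Z.*-distribˡ-Σ (leading) (λ j → V zero j ℤ.* w j) ⟩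
    sumℤ (λ j → leading ℤ.* (V zero j ℤ.* w j))
      ≡⟨ Z.Σ-cong (λ j → trans (sym (ℤP.*-assoc leading (V zero j) (w j)))
                                (cong (ℤ._* w j) (sym (a≡leading*V₀ j)))) ⟩
    dotℤ a w ≡⟨ ⟨a,w⟩≡1 ⟩
    + 1 ∎
  C⊙S≐0 : (λ c → V (suc c)) ⊙ S₁ ≐ 𝟘
  C⊙S≐0 c _ = trans (sym (Σ-U₀-u₀ (V (suc c)))) (trans (cong (ℤ._* u₀) (V⊙U≐I (suc c) zero)) refl)
  K⊙C⊞S⊙E≐I : (λ j c → U j (suc c)) ⊙ (λ c → V (suc c)) ⊞ S₁ ⊙ (λ _ → a) ≐ unit
  K⊙C⊞S⊙E≐I j j′ = begin
    KC ℤ.+ (U j zero ℤ.* u₀ ℤ.* a j′ ℤ.+ + 0)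
      ≡⟨ cong (ℤ._+_ KC) (trans (ℤP.+-identityʳ _) U₀u₀a≡U₀V₀) ⟩
    KC ℤ.+ U j zero ℤ.* V zero j′ ≡⟨ ℤP.+-comm KC (U j zero ℤ.* V zero j′) ⟩
    (U ⊙ V) j j′ ≡⟨ U⊙V≐I j j′ ⟩
    unit j j′ ∎
    where
    KC : ℤ
    KC = sumℤ (λ c → U j (suc c) ℤ.* V (suc c) j′)
    regroup : ∀ x u g v → x ℤ.* u ℤ.* (g ℤ.* v) ≡ x ℤ.* (g ℤ.* u) ℤ.* v
    regroup = solve-∀
    U₀u₀a≡U₀V₀ : U j zero ℤ.* u₀ ℤ.* a j′ ≡ U j zero ℤ.* V zero j′
    U₀u₀a≡U₀V₀ = begin
      U j zero ℤ.* u₀ ℤ.* a j′ ≡⟨ cong (U j zero ℤ.* u₀ ℤ.*_) (a≡leading*V₀ j′) ⟩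
      U j zero ℤ.* u₀ ℤ.* (leading ℤ.* V zero j′) ≡⟨ regroup (U j zero) u₀ (leading) (V zero j′) ⟩
      U j zero ℤ.* (leading ℤ.* u₀) ℤ.* V zero j′ ≡⟨ cong (λ z → U j zero ℤ.* z ℤ.* V zero j′) leading*u₀≡1 ⟩
      U j zero ℤ.* + 1 ℤ.* V zero j′ ≡⟨ cong (ℤ._* V zero j′) (ℤP.*-identityʳ (U j zero)) ⟩
      U j zero ℤ.* V zero j′ ∎

K⊙C≐I-S⊙E : ∀ {d r} {E : Mat r d} (c : Complement E) →
  let open Complement c in K ⊙ C ≐ unit ⊞ ⊟ (S ⊙ E)
K⊙C≐I-S⊙E c j j′ = subtract _ _ _ (Complement.K⊙C⊞S⊙E≐I c j j′)
  where
  subtract : ∀ x y u → x ℤ.+ y ≡ u → x ≡ u ℤ.+ ℤ.- y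
  subtract x y u x+y≡u = trans (x≡x+y-y x y) (cong (ℤ._+ ℤ.- y) x+y≡u)
    where
    x≡x+y-y : ∀ x y → x ≡ (x ℤ.+ y) ℤ.+ ℤ.- y
    x≡x+y-y = solve-∀

-- To complement E, complement its first row a₁, then complement the other rows restricted to ker a₁.
module ComplementStep {d r} (E : Mat (suc r) d)
  (c₁ : Complement {d} {1} (λ _ → E zero))
  (c₂ : Complement ((λ i → E (suc i)) ⊙ Complement.K c₁)) where

  a₁ : Mat 1 d
  a₁ _ = E zero

  E′ : Mat r d
  E′ i = E (suc i)

  open Complement c₁ using ()
    renaming (C to C₁; K to K₁; S to S₁; C⊙K≐I to C₁⊙K₁≐I; E⊙K≐0 to a₁⊙K₁≐0; C⊙S≐0 to C₁⊙S₁≐0;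
              E⊙S≐I to a₁⊙S₁≐I; K⊙C⊞S⊙E≐I to K₁⊙C₁⊞S₁⊙a₁≐I)
  open Complement c₂ using ()
    renaming (e to e₂; C to C₂; K to K₂; S to S₂; C⊙K≐I to C₂⊙K₂≐I; E⊙K≐0 to E′K₁⊙K₂≐0; C⊙S≐0 to C₂⊙S₂≐0;
              E⊙S≐I to E′K₁⊙S₂≐I)

  C : Mat e₂ d
  C = C₂ ⊙ C₁

  K : Mat d e₂
  K = K₁ ⊙ K₂

  M : Mat d r
  M = K₁ ⊙ S₂

  c : Mat r 1
  c = E′ ⊙ S₁

  s₀ : Mat d 1
  s₀ = S₁ ⊞ ⊟ (M ⊙ c)

  S : Mat d (suc r)
  S j zero = s₀ j zero
  S j (suc i) = M j i

  C⊙K≐I : C ⊙ K ≐ unit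
  C⊙K≐I = ≐-trans (Z.⊙-cancel-inner C₂ C₁ K₁ K₂ C₁⊙K₁≐I) C₂⊙K₂≐I

  E⊙K≐0 : E ⊙ K ≐ 𝟘
  E⊙K≐0 zero b = trans (sym (Z.⊙-assoc a₁ K₁ K₂ zero b)) (Z.⊙-zeroˡ K₂ a₁⊙K₁≐0 zero b)
  E⊙K≐0 (suc i) b = trans (sym (Z.⊙-assoc E′ K₁ K₂ i b)) (E′K₁⊙K₂≐0 i b)

  C⊙M≐0 : C ⊙ M ≐ 𝟘
  C⊙M≐0 = ≐-trans (Z.⊙-cancel-inner C₂ C₁ K₁ S₂ C₁⊙K₁≐I) C₂⊙S₂≐0

  a₁⊙M≐0 : a₁ ⊙ M ≐ 𝟘
  a₁⊙M≐0 z i = trans (sym (Z.⊙-assoc a₁ K₁ S₂ z i)) (Z.⊙-zeroˡ S₂ a₁⊙K₁≐0 z i)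

  E′⊙M≐I : E′ ⊙ M ≐ unit
  E′⊙M≐I i i′ = trans (sym (Z.⊙-assoc E′ K₁ S₂ i i′)) (E′K₁⊙S₂≐I i i′)

  ⊙s₀ : ∀ {a} (X : Mat a d) i → (X ⊙ s₀) i zero ≡ (X ⊙ S₁) i zero - ((X ⊙ M) ⊙ c) i zero
  ⊙s₀ X i = trans (Z.⊙-distribˡ-⊞ X S₁ (⊟ (M ⊙ c)) i zero)
    (cong ((X ⊙ S₁) i zero Z.+_) (trans (Z.⊙-negʳ X (M ⊙ c) i zero) (cong ℤ.-_ (sym (Z.⊙-assoc X M c i zero)))))

  C⊙S≐0 : C ⊙ S ≐ 𝟘
  C⊙S≐0 a (suc i) = C⊙M≐0 a i
  C⊙S≐0 a zero = trans (⊙s₀ C a) (cong₂ Z._-_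
    (trans (Z.⊙-assoc C₂ C₁ S₁ a zero) (Z.⊙-zeroʳ C₂ C₁⊙S₁≐0 a zero)) (Z.⊙-zeroˡ c C⊙M≐0 a zero))

  E⊙S≐I : E ⊙ S ≐ unit
  E⊙S≐I zero zero = trans (⊙s₀ a₁ zero) (cong₂ Z._-_ (a₁⊙S₁≐I zero zero) (Z.⊙-zeroˡ c a₁⊙M≐0 zero zero))
  E⊙S≐I zero (suc i′) = a₁⊙M≐0 zero i′
  E⊙S≐I (suc i) zero = trans (⊙s₀ E′ i)
    (trans (cong (Z._-_ (c i zero)) (trans (Z.⊙-congˡ c E′⊙M≐I i zero) (Z.⊙-identityˡ c i zero)))
      (ℤP.+-inverseʳ (c i zero)))
  E⊙S≐I (suc i) (suc i′) = trans (E′⊙M≐I i i′) (sym (Z.δ-suc i i′))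

  E′K₁⊙C₁≐E′-c⊙a₁ : (E′ ⊙ K₁) ⊙ C₁ ≐ E′ ⊞ ⊟ (c ⊙ a₁)
  E′K₁⊙C₁≐E′-c⊙a₁ i j = begin
    ((E′ ⊙ K₁) ⊙ C₁) i j ≡⟨ Z.⊙-assoc E′ K₁ C₁ i j ⟩
    (E′ ⊙ (K₁ ⊙ C₁)) i j ≡⟨ Z.⊙-congʳ E′ (K⊙C≐I-S⊙E c₁) i j ⟩
    (E′ ⊙ (unit ⊞ ⊟ (S₁ ⊙ a₁))) i j ≡⟨ Z.⊙-distribˡ-⊞ E′ unit (⊟ (S₁ ⊙ a₁)) i j ⟩
    (E′ ⊙ unit) i j Z.+ (E′ ⊙ ⊟ (S₁ ⊙ a₁)) i j
      ≡⟨ cong₂ Z._+_ (Z.⊙-identityʳ E′ i j)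
           (trans (Z.⊙-negʳ E′ (S₁ ⊙ a₁) i j) (cong Z.-_ (sym (Z.⊙-assoc E′ S₁ a₁ i j)))) ⟩
    E′ i j Z.- (c ⊙ a₁) i j ∎

  K⊙C≐ : ∀ j j′ → (K ⊙ C) j j′ ≡ (K₁ ⊙ C₁) j j′ Z.- ((M ⊙ E′) j j′ Z.- ((M ⊙ c) ⊙ a₁) j j′)
  K⊙C≐ j j′ = begin
    (K ⊙ C) j j′ ≡⟨ Z.⊙-assoc K₁ K₂ C j j′ ⟩
    (K₁ ⊙ (K₂ ⊙ C)) j j′ ≡⟨ Z.⊙-congʳ K₁ (λ u v → sym (Z.⊙-assoc K₂ C₂ C₁ u v)) j j′ ⟩
    (K₁ ⊙ ((K₂ ⊙ C₂) ⊙ C₁)) j j′ ≡⟨ Z.⊙-congʳ K₁ (Z.⊙-congˡ C₁ (K⊙C≐I-S⊙E c₂)) j j′ ⟩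
    (K₁ ⊙ ((unit ⊞ ⊟ (S₂ ⊙ (E′ ⊙ K₁))) ⊙ C₁)) j j′
      ≡⟨ Z.⊙-congʳ K₁ (Z.⊙-distribʳ-⊞ unit (⊟ (S₂ ⊙ (E′ ⊙ K₁))) C₁) j j′ ⟩
    (K₁ ⊙ (unit ⊙ C₁ ⊞ (⊟ (S₂ ⊙ (E′ ⊙ K₁))) ⊙ C₁)) j j′
      ≡⟨ Z.⊙-distribˡ-⊞ K₁ (unit ⊙ C₁) ((⊟ (S₂ ⊙ (E′ ⊙ K₁))) ⊙ C₁) j j′ ⟩
    (K₁ ⊙ (unit ⊙ C₁)) j j′ Z.+ (K₁ ⊙ ((⊟ (S₂ ⊙ (E′ ⊙ K₁))) ⊙ C₁)) j j′
      ≡⟨ cong₂ Z._+_ (Z.⊙-congʳ K₁ (Z.⊙-identityˡ C₁) j j′) correction ⟩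
    (K₁ ⊙ C₁) j j′ Z.- ((M ⊙ E′) j j′ Z.- ((M ⊙ c) ⊙ a₁) j j′) ∎
    where
    correction : (K₁ ⊙ ((⊟ (S₂ ⊙ (E′ ⊙ K₁))) ⊙ C₁)) j j′ ≡ Z.- ((M ⊙ E′) j j′ Z.- ((M ⊙ c) ⊙ a₁) j j′)
    correction = begin
      (K₁ ⊙ ((⊟ (S₂ ⊙ (E′ ⊙ K₁))) ⊙ C₁)) j j′ ≡⟨ Z.⊙-congʳ K₁ (Z.⊙-negˡ (S₂ ⊙ (E′ ⊙ K₁)) C₁) j j′ ⟩
      (K₁ ⊙ ⊟ ((S₂ ⊙ (E′ ⊙ K₁)) ⊙ C₁)) j j′ ≡⟨ Z.⊙-negʳ K₁ ((S₂ ⊙ (E′ ⊙ K₁)) ⊙ C₁) j j′ ⟩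
      Z.- (K₁ ⊙ ((S₂ ⊙ (E′ ⊙ K₁)) ⊙ C₁)) j j′
        ≡⟨ cong Z.-_ (trans (Z.⊙-congʳ K₁ (Z.⊙-assoc S₂ (E′ ⊙ K₁) C₁) j j′)
                             (sym (Z.⊙-assoc K₁ S₂ ((E′ ⊙ K₁) ⊙ C₁) j j′))) ⟩
      Z.- (M ⊙ ((E′ ⊙ K₁) ⊙ C₁)) j j′ ≡⟨ cong Z.-_ (Z.⊙-congʳ M E′K₁⊙C₁≐E′-c⊙a₁ j j′) ⟩
      Z.- (M ⊙ (E′ ⊞ ⊟ (c ⊙ a₁))) j j′ ≡⟨ cong Z.-_ (Z.⊙-distribˡ-⊞ M E′ (⊟ (c ⊙ a₁)) j j′) ⟩
      Z.- ((M ⊙ E′) j j′ Z.+ (M ⊙ ⊟ (c ⊙ a₁)) j j′)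
        ≡⟨ cong (λ z → Z.- ((M ⊙ E′) j j′ Z.+ z))
             (trans (Z.⊙-negʳ M (c ⊙ a₁) j j′) (cong Z.-_ (sym (Z.⊙-assoc M c a₁ j j′)))) ⟩
      Z.- ((M ⊙ E′) j j′ Z.- ((M ⊙ c) ⊙ a₁) j j′) ∎

  K⊙C⊞S⊙E≐I : K ⊙ C ⊞ S ⊙ E ≐ unit
  K⊙C⊞S⊙E≐I j j′ = begin
    (K ⊙ C) j j′ ℤ.+ (s₀ j zero ℤ.* E zero j′ ℤ.+ (M ⊙ E′) j j′)
      ≡⟨ cong₂ ℤ._+_ (K⊙C≐ j j′)
           (cong (ℤ._+ (M ⊙ E′) j j′) (ℤP.*-distribʳ-+ (E zero j′) (S₁ j zero) _)) ⟩
    (X ℤ.+ ℤ.- (P ℤ.+ ℤ.- (Q ℤ.+ + 0))) ℤ.+ ((Y ℤ.+ ℤ.- (M ⊙ c) j zero ℤ.* E zero j′) ℤ.+ P)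
      ≡⟨ cong (λ z → (X ℤ.+ ℤ.- (P ℤ.+ ℤ.- (Q ℤ.+ + 0))) ℤ.+ ((Y ℤ.+ z) ℤ.+ P))
           (sym (ℤP.neg-distribˡ-* ((M ⊙ c) j zero) (E zero j′))) ⟩
    (X ℤ.+ ℤ.- (P ℤ.+ ℤ.- (Q ℤ.+ + 0))) ℤ.+ ((Y ℤ.+ ℤ.- Q) ℤ.+ P) ≡⟨ cancel X Y P Q ⟩
    X ℤ.+ (Y ℤ.+ + 0) ≡⟨ K₁⊙C₁⊞S₁⊙a₁≐I j j′ ⟩
    unit j j′ ∎
    where
    X Y P Q : ℤ
    X = (K₁ ⊙ C₁) j j′
    Y = S₁ j zero ℤ.* E zero j′
    P = (M ⊙ E′) j j′
    Q = (M ⊙ c) j zero ℤ.* E zero j′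
    cancel : ∀ X Y P Q → (X ℤ.+ ℤ.- (P ℤ.+ ℤ.- (Q ℤ.+ + 0))) ℤ.+ ((Y ℤ.+ ℤ.- Q) ℤ.+ P) ≡ X ℤ.+ (Y ℤ.+ + 0)
    cancel = solve-∀

  complement : Complement E
  complement = record
    { e = e₂ ; C = C ; K = K ; S = S ; C⊙K≐I = C⊙K≐I ; E⊙K≐0 = E⊙K≐0 ; C⊙S≐0 = C⊙S≐0
    ; E⊙S≐I = E⊙S≐I ; K⊙C⊞S⊙E≐I = K⊙C⊞S⊙E≐I }

complementOf : ∀ {d} r (E : Mat r d) (S : Mat d r) → E ⊙ S ≐ unit → Complement E
complementOf zero E _ _ = complement-empty E
complementOf (suc r) E S E⊙S≐I = ComplementStep.complement E c₁ c₂
  where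
  c₁ : Complement {r = 1} (λ _ → E zero)
  c₁ = complement-row (E zero) (λ j → S j zero) (E⊙S≐I zero zero)
  open Complement c₁ using (C; K) renaming (S to S₁)
  E′ : Mat r _
  E′ i = E (suc i)
  S′ : Mat _ r
  S′ j i = S j (suc i)
  -- S′ lands in ker E₀, on which K C acts as the identity.
  E′K⊙CS′≐I : (E′ ⊙ K) ⊙ (C ⊙ S′) ≐ unit
  E′K⊙CS′≐I i i′ = begin
    ((E′ ⊙ K) ⊙ (C ⊙ S′)) i i′ ≡⟨ Z.⊙-assoc E′ K (C ⊙ S′) i i′ ⟩
    (E′ ⊙ (K ⊙ (C ⊙ S′))) i i′ ≡⟨ Z.⊙-congʳ E′ (λ j l → sym (Z.⊙-assoc K C S′ j l)) i i′ ⟩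
    (E′ ⊙ ((K ⊙ C) ⊙ S′)) i i′ ≡⟨ Z.⊙-congʳ E′ (Z.⊙-congˡ S′ (K⊙C≐I-S⊙E c₁)) i i′ ⟩
    (E′ ⊙ ((unit ⊞ ⊟ (S₁ ⊙ E₀)) ⊙ S′)) i i′
      ≡⟨ Z.⊙-congʳ E′ (≐-trans (Z.⊙-distribʳ-⊞ unit (⊟ (S₁ ⊙ E₀)) S′)
           (λ j l → cong₂ Z._+_ (Z.⊙-identityˡ S′ j l) (S₁E₀S′≐0 j l))) i i′ ⟩
    (E′ ⊙ (S′ ⊞ 𝟘)) i i′ ≡⟨ Z.⊙-congʳ E′ (λ j l → ℤP.+-identityʳ (S′ j l)) i i′ ⟩
    (E′ ⊙ S′) i i′ ≡⟨ trans (E⊙S≐I (suc i) (suc i′)) (Z.δ-suc i i′) ⟩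
    unit i i′ ∎
    where
    E₀ : Mat 1 _
    E₀ _ = E zero
    S₁E₀S′≐0 : (⊟ (S₁ ⊙ E₀)) ⊙ S′ ≐ 𝟘
    S₁E₀S′≐0 j l = trans (Z.⊙-negˡ (S₁ ⊙ E₀) S′ j l) (cong Z.-_ (trans (Z.⊙-assoc S₁ E₀ S′ j l)
      (Z.⊙-zeroʳ S₁ (λ _ l → E⊙S≐I zero (suc l)) j l)))
  c₂ : Complement (E′ ⊙ K)
  c₂ = complementOf r (E′ ⊙ K) (C ⊙ S′) E′K⊙CS′≐I

unit-↑ˡ : ∀ {e} r (a b : Fin e) → unit (a ↑ˡ r) (b ↑ˡ r) ≡ unit a b
unit-↑ˡ r a b with a Fin.≟ b
... | yes refl = unit-diag _
... | no a≢b = unit-offdiag (λ eq → a≢b (↑ˡ-injective r a b eq))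

unit-↑ʳ : ∀ e {r} (i i′ : Fin r) → unit (e ↑ʳ i) (e ↑ʳ i′) ≡ unit i i′
unit-↑ʳ e i i′ with i Fin.≟ i′
... | yes refl = unit-diag _
... | no i≢i′ = unit-offdiag (λ eq → i≢i′ (↑ʳ-injective e i i′ eq))

↑ˡ≢↑ʳ : ∀ e r (a : Fin e) (i : Fin r) → ¬ a ↑ˡ r ≡ e ↑ʳ i
↑ˡ≢↑ʳ e r a i eq with trans (sym (splitAt-↑ˡ e a r)) (trans (cong (splitAt e) eq) (splitAt-↑ʳ e r i))
... | ()

ExtendsToBasis : ∀ {d r} → Mat r d → Set
ExtendsToBasis {d} {r} E = Σ ℕ λ e → Σ (LatticeIso d (e +ℕ r)) λ φ → ∀ i j → proj₁ φ (e ↑ʳ i) j ≡ E i j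

complement⇒extendsToBasis : ∀ {d r} {E : Mat r d} → Complement E → ExtendsToBasis E
complement⇒extendsToBasis {d} {r} {E} c = e , (A , B , A⊙B≐I , B⊙A≐I) , A-↑ʳ
  where
  open Complement c
  A : Mat (e +ℕ r) d
  A t = [ C , E ]′ (splitAt e t)
  B : Mat d (e +ℕ r)
  B j t = [ K j , S j ]′ (splitAt e t)
  A-↑ˡ : ∀ a j → A (a ↑ˡ r) j ≡ C a j
  A-↑ˡ a j rewrite splitAt-↑ˡ e a r = refl
  A-↑ʳ : ∀ i j → A (e ↑ʳ i) j ≡ E i j
  A-↑ʳ i j rewrite splitAt-↑ʳ e r i = refl
  B-↑ˡ : ∀ j a → B j (a ↑ˡ r) ≡ K j a
  B-↑ˡ j a rewrite splitAt-↑ˡ e a r = refl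
  B-↑ʳ : ∀ j i → B j (e ↑ʳ i) ≡ S j i
  B-↑ʳ j i rewrite splitAt-↑ʳ e r i = refl
  A⊙B-join : ∀ x y → (A ⊙ B) (join e r x) (join e r y) ≡ unit (join e r x) (join e r y)
  A⊙B-join (inj₁ a) (inj₁ b) = trans (Z.Σ-cong (λ j → cong₂ ℤ._*_ (A-↑ˡ a j) (B-↑ˡ j b)))
    (trans (C⊙K≐I a b) (sym (unit-↑ˡ r a b)))
  A⊙B-join (inj₁ a) (inj₂ i) = trans (Z.Σ-cong (λ j → cong₂ ℤ._*_ (A-↑ˡ a j) (B-↑ʳ j i)))
    (trans (C⊙S≐0 a i) (sym (unit-offdiag (↑ˡ≢↑ʳ e r a i))))
  A⊙B-join (inj₂ i) (inj₁ b) = trans (Z.Σ-cong (λ j → cong₂ ℤ._*_ (A-↑ʳ i j) (B-↑ˡ j b)))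
    (trans (E⊙K≐0 i b) (sym (unit-offdiag (λ eq → ↑ˡ≢↑ʳ e r b i (sym eq)))))
  A⊙B-join (inj₂ i) (inj₂ i′) = trans (Z.Σ-cong (λ j → cong₂ ℤ._*_ (A-↑ʳ i j) (B-↑ʳ j i′)))
    (trans (E⊙S≐I i i′) (sym (unit-↑ʳ e i i′)))
  A⊙B≐I : A ⊙ B ≐ unit
  A⊙B≐I t t′ = subst₂ (λ t t′ → (A ⊙ B) t t′ ≡ unit t t′) (join-splitAt e r t) (join-splitAt e r t′)
    (A⊙B-join (splitAt e t) (splitAt e t′))
  B⊙A≐I : B ⊙ A ≐ unit
  B⊙A≐I j j′ = trans (Z.Σ-splitAt e (λ t → B j t ℤ.* A t j′))
    (trans (cong₂ ℤ._+_ (Z.Σ-cong (λ a → cong₂ ℤ._*_ (B-↑ˡ j a) (A-↑ˡ a j′)))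
                        (Z.Σ-cong (λ i → cong₂ ℤ._*_ (B-↑ʳ j i) (A-↑ʳ i j′))))
      (K⊙C⊞S⊙E≐I j j′))

-- Reflexive Gorenstein cones

CayleyCone-resp-≗ : ∀ {e r} {k : Fin r → ℕ} {V : (i : Fin r) → Fin (k i) → Vecℤ e} {y y′ : Vecℚ (e +ℕ r)} →
  CayleyCone k V y → (∀ t → y t ≡ y′ t) → CayleyCone k V y′
CayleyCone-resp-≗ (c , c∈ , y≡) y≗y′ = c , c∈ , (λ t → trans (sym (y≗y′ t)) (y≡ t))

liftPt-↑ˡ : ∀ {e r} (u : Vecℤ e) (i : Fin r) (a : Fin e) → liftPt {e} u i (a ↑ˡ r) ≡ u a
liftPt-↑ˡ {e} {r} u i a rewrite splitAt-↑ˡ e a r = refl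

liftPt-↑ʳ : ∀ {e r} (u : Vecℤ e) (i i′ : Fin r) → liftPt {e} u i (e ↑ʳ i′) ≡ unit i i′
liftPt-↑ʳ {e} {r} u i i′ rewrite splitAt-↑ʳ e r i′ = refl

CayleyCone-vertex : ∀ {e r} (k : Fin r → ℕ) (V : (i : Fin r) → Fin (k i) → Vecℤ e) i l →
  CayleyCone k V (toℚ (liftPt (V i l) i))
CayleyCone-vertex {e} {r} k V i l = c , c∈ , (λ t → sym (Q.Σ-δˡ i (λ _ → toℚ (liftPt (V i l) i) t)))
  where
  c : Fin r → Vecℚ (e +ℕ r)
  c i′ t = δℚ i i′ ℚ.* toℚ (liftPt (V i l) i) t
  c∈ : ∀ i′ → InCone (λ j → toℚ (liftPt (V i′ j) i′)) (c i′)
  c∈ i′ with i Fin.≟ i′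
  ... | yes refl = InCone-resp-≗ _ (InCone-generator _ l) (λ t → sym (ℚP.*-identityˡ _))
  ... | no _ = InCone-resp-≗ _ (InCone-0 _) (λ t → sym (ℚP.*-zeroˡ (toℚ (liftPt (V i l) i) t)))

applyIso-inverse : ∀ {d} e {r} (φ : LatticeIso d (e +ℕ r)) q t →
  applyIso φ (toℚ (proj₁ (proj₂ φ) Z.▷ q)) t ≡ toℚ q t
applyIso-inverse e (A , B , AB≐δ , _) q t =
  trans (Q.▷-cong (ιMat A) (λ s → ι-dot (B s) q) t) (Q.▷-cancel (ιMat A) (ιMat B) (ι-⊙≐δ A B AB≐δ) (toℚ q) t)

inverse-applyIso : ∀ {d} e {r} (φ : LatticeIso d (e +ℕ r)) x s →
  (ιMat (proj₁ (proj₂ φ)) Q.▷ applyIso φ x) s ≡ x s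
inverse-applyIso e (A , B , _ , BA≐δ) = Q.▷-cancel (ιMat B) (ιMat A) (ι-⊙≐δ B A BA≐δ)

+1≢+0 : ¬ (+ 1) ≡ + 0
+1≢+0 ()

dot≢0⇒nonzero : ∀ {d} (v x : Vecℤ d) → ¬ dotℤ v x ≡ + 0 → Σ (Fin d) λ t → ¬ v t ≡ + 0
dot≢0⇒nonzero {d} v x ⟨v,x⟩≢0 = ¬∀⟶∃¬ d (λ t → v t ≡ + 0) (λ t → v t ℤ.≟ + 0)
  (λ v≡0 → ⟨v,x⟩≢0 (Z.Σ-zero (λ t → cong (ℤ._* x t) (v≡0 t))))

Σdot≡dotΣ : ∀ {d r} (E : Fin r → Vecℤ d) (n : Vecℤ d) → (∀ t → sumℤ (λ i → E i t) ≡ n t) →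
  ∀ x → sumℤ (λ i → dotℤ (E i) x) ≡ dotℤ n x
Σdot≡dotΣ E n ΣE≡n x = trans (sym (Z.dot-Σˡ E x)) (Z.Σ-cong (λ t → cong (ℤ._* x t) (ΣE≡n t)))

Σdot≡dotΣℚ : ∀ {d r} (E : Fin r → Vecℤ d) (n : Vecℤ d) → (∀ t → sumℤ (λ i → E i t) ≡ n t) →
  ∀ x → sumℚ (λ i → dotℚ (toℚ (E i)) x) ≡ dotℚ (toℚ n) x
Σdot≡dotΣℚ E n ΣE≡n x = trans (sym (Q.dot-Σˡ (λ i → toℚ (E i)) x))
  (Q.Σ-cong (λ t → cong (ℚ._* x t) (trans (sym (ι-Σ (λ i → E i t))) (cong ι (ΣE≡n t)))))

module ReflexivePair {d : ℕ} (σ : Vecℚ d → Set) (n m : Vecℤ d) (r : ℕ)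
  (Gσ : IsGorenstein σ n) (Gσ∨ : IsGorenstein (Dual σ) m) (⟨m,n⟩≡r : dotℤ m n ≡ + r) where

  module S = Gorenstein Gσ
  module S∨ = Gorenstein Gσ∨

  Support-gen : ∀ j → Support σ n (S.Gen j)
  Support-gen j = S.C-gen j , trans (sym (ι-dot (S.gen j) n)) (cong ι (S.⟨gen,w⟩≡1 j))

  -- The ⟨E i , m⟩ are integers ≥ 1 summing to ⟨n , m⟩ = r.
  index-one : (E : Fin r → Vecℤ d) → (∀ i → Dual σ (toℚ (E i))) → (∀ t → sumℤ (λ i → E i t) ≡ n t) →
    (∀ i → Σ (Fin d) λ t → ¬ E i t ≡ + 0) → ∀ i → dotℤ m (E i) ≡ + 1
  index-one E E∈σ∨ ΣE≡n E≢0 i = trans (Z.dot-comm m (E i))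
    (all≥1∧Σ≡r⇒all≡1 (λ i → dotℤ (E i) m)
      (λ i → S∨.nonzero⇒1≤⟨v,w⟩ (E i) (E∈σ∨ i) (proj₁ (E≢0 i)) (proj₂ (E≢0 i)))
      (trans (Σdot≡dotΣ E n ΣE≡n m) (trans (Z.dot-comm n m) ⟨m,n⟩≡r)) i)

  module FromSplitting (E : Fin r → Vecℤ d) (split : IsSplitting σ n m E) where

    E∈σ∨ : ∀ i → Dual σ (toℚ (E i))
    E∈σ∨ i = proj₁ (proj₁ split i)

    ΣE≡n : ∀ t → sumℤ (λ i → E i t) ≡ n t
    ΣE≡n = proj₂ split

    val : Fin S.k → Fin r → ℤ
    val j i = dotℤ (S.gen j) (E i)

    val-nonneg : ∀ j i → + 0 ℤ.≤ val j i
    val-nonneg j i = ι-cancel-≤ (subst (0ℚ ℚ.≤_) (sym (ι-dot (S.gen j) (E i))) (E∈σ∨ i (S.Gen j) (S.C-gen j)))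

    Σval≡1 : ∀ j → sumℤ (val j) ≡ + 1
    Σval≡1 j = trans (Z.Σ-cong (λ i → Z.dot-comm (S.gen j) (E i)))
      (trans (Σdot≡dotΣ E n ΣE≡n (S.gen j)) (trans (Z.dot-comm n (S.gen j)) (S.⟨gen,w⟩≡1 j)))

    -- Otherwise E i would vanish on every generator, hence be 0, contradicting ⟨m , E i⟩ = 1.
    vertex : ∀ i → Σ (Fin S.k) λ j → val j i ≡ + 1
    vertex i with any? (λ j → val j i ℤ.≟ + 1)
    ... | yes found = found
    ... | no none = ⊥-elim (+1≢+0 (trans (sym (proj₂ (proj₁ split i))) (Z.Σ-zero (λ t →
        trans (cong (m t ℤ.*_) (Eᵢ≡0 t)) (ℤP.*-zeroʳ (m t))))))
      where
      val≡0 : ∀ j → val j i ≡ + 0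
      val≡0 j with nonneg∧Σ≡1⇒0or1 (val j) (val-nonneg j) (Σval≡1 j) i
      ... | inj₁ v≡0 = v≡0
      ... | inj₂ v≡1 = ⊥-elim (none (j , v≡1))
      Eᵢ≡0 : ∀ t → E i t ≡ + 0
      Eᵢ≡0 = S.agree-on-gens (E i) (λ _ → + 0)
        (λ j → trans (val≡0 j) (sym (Z.Σ-zero (λ t → ℤP.*-zeroʳ (S.gen j t)))))

    val-vertex : ∀ i i′ → val (proj₁ (vertex i)) i′ ≡ unit i i′
    val-vertex i = nonneg∧Σ≡1⇒≡unit (val (proj₁ (vertex i))) (val-nonneg _) (Σval≡1 _) i (proj₂ (vertex i))

    level-preserved : ∀ x → dotℤ x n ≡ + 1 → sumℤ (applyℤ E x) ≡ + 1
    level-preserved x ⟨x,n⟩≡1 = trans (Σdot≡dotΣ E n ΣE≡n x) (trans (Z.dot-comm n x) ⟨x,n⟩≡1)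

    level-onto : ∀ (z : Vecℤ r) → sumℤ z ≡ + 1 →
      Σ (Vecℤ d) λ x → dotℤ x n ≡ + 1 × (∀ i → applyℤ E x i ≡ z i)
    level-onto z Σz≡1 = x , ⟨x,n⟩≡1 , Ex≡z
      where
      V : Fin r → Vecℤ d
      V i = S.gen (proj₁ (vertex i))
      x : Vecℤ d
      x t = sumℤ (λ i → z i ℤ.* V i t)
      ⟨x,n⟩≡1 : dotℤ x n ≡ + 1
      ⟨x,n⟩≡1 = trans (Z.dot-combinationˡ z V (λ _ → refl) n)
        (trans (Z.Σ-cong (λ i → trans (cong (z i ℤ.*_) (S.⟨gen,w⟩≡1 _)) (ℤP.*-identityʳ (z i)))) Σz≡1)
      Ex≡z : ∀ i → applyℤ E x i ≡ z i
      Ex≡z i′ = trans (Z.dot-comm (E i′) x) (trans (Z.dot-combinationˡ z V (λ _ → refl) (E i′))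
        (trans (Z.Σ-cong (λ i → cong (z i ℤ.*_) (val-vertex i i′))) (Z.Σ-δʳ i′ z)))

    Support-into-simplex : ∀ x → Support σ n x → InConv (λ i → toℚ (unit i)) (applyℚ E x)
    Support-into-simplex x (x∈σ , ⟨x,n⟩≡1) =
      applyℚ E x ,
      (λ i → subst (0ℚ ℚ.≤_) (Q.dot-comm x (toℚ (E i))) (E∈σ∨ i x x∈σ)) ,
      trans (Σdot≡dotΣℚ E n ΣE≡n x) (trans (Q.dot-comm (toℚ n) x) ⟨x,n⟩≡1) ,
      (λ i → sym (Q.Σ-δʳ i (applyℚ E x)))

    Support-onto-simplex : ∀ (z : Vecℚ r) → InConv (λ i → toℚ (unit i)) z →
      Σ (Vecℚ d) λ x → Support σ n x × (∀ i → applyℚ E x i ≡ z i)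
    Support-onto-simplex z (c , 0≤c , Σc≡1 , z≡) = x , (x∈σ , ⟨x,n⟩≡1) , Ex≡z
      where
      V : Fin r → Vecℚ d
      V i = S.Gen (proj₁ (vertex i))
      x : Vecℚ d
      x t = sumℚ (λ i → c i ℚ.* V i t)
      x∈σ : σ x
      x∈σ = S.C-Σ (λ i t → c i ℚ.* V i t) (λ i → S.C-scale (c i) (0≤c i) (S.C-gen _))
      ⟨x,n⟩≡1 : dotℚ x (toℚ n) ≡ 1ℚ
      ⟨x,n⟩≡1 = trans (Q.dot-combinationˡ c V (λ _ → refl) (toℚ n))
        (trans (Q.Σ-cong (λ i → trans (cong (c i ℚ.*_) (proj₂ (Support-gen _))) (ℚP.*-identityʳ (c i)))) Σc≡1)
      Ex≡z : ∀ i → applyℚ E x i ≡ z i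
      Ex≡z i′ = begin
        dotℚ (toℚ (E i′)) x ≡⟨ Q.dot-comm (toℚ (E i′)) x ⟩
        dotℚ x (toℚ (E i′)) ≡⟨ Q.dot-combinationˡ c V (λ _ → refl) (toℚ (E i′)) ⟩
        sumℚ (λ i → c i ℚ.* dotℚ (V i) (toℚ (E i′)))
          ≡⟨ Q.Σ-cong (λ i → cong (c i ℚ.*_) (trans (S.⟨gen,u⟩ℚ _ (E i′)) (cong ι (val-vertex i i′)))) ⟩
        sumℚ (λ i → c i ℚ.* δℚ i i′) ≡⟨ Q.Σ-δʳ i′ c ⟩
        c i′ ≡⟨ sym (trans (z≡ i′) (Q.Σ-δʳ i′ c)) ⟩
        z i′ ∎

    cayleyStructure : IsCayleyStructure σ n E
    cayleyStructure = level-preserved , level-onto , Support-into-simplex , Support-onto-simplex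

  module FromCayleyStructure (L : Fin r → Vecℤ d) (cayley : IsCayleyStructure σ n L) where

    L∈σ∨ : ∀ i → Dual σ (toℚ (L i))
    L∈σ∨ i x x∈σ = subst (0ℚ ℚ.≤_) (sym (S.dot-toCone x∈σ (toℚ (L i))))
      (QO.Σ-nonneg (λ j → *-nonnegℚ (proj₁ (proj₂ (S.toCone x∈σ)) j) (0≤⟨gen,L⟩ j)))
      where
      0≤⟨gen,L⟩ : ∀ j → 0ℚ ℚ.≤ dotℚ (S.Gen j) (toℚ (L i))
      0≤⟨gen,L⟩ j with proj₁ (proj₂ (proj₂ cayley)) (S.Gen j) (Support-gen j)
      ... | c , 0≤c , _ , Lgⱼ≡c = subst (0ℚ ℚ.≤_)
        (sym (trans (Q.dot-comm (S.Gen j) (toℚ (L i))) (trans (Lgⱼ≡c i) (Q.Σ-δʳ i c)))) (0≤c i)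

    ΣL≡n : ∀ t → sumℤ (λ i → L i t) ≡ n t
    ΣL≡n = S.agree-on-gens (λ t → sumℤ (λ i → L i t)) n λ j → begin
      dotℤ (S.gen j) (λ t → sumℤ (λ i → L i t)) ≡⟨ Z.dot-comm (S.gen j) _ ⟩
      dotℤ (λ t → sumℤ (λ i → L i t)) (S.gen j) ≡⟨ Z.dot-Σˡ L (S.gen j) ⟩
      sumℤ (applyℤ L (S.gen j)) ≡⟨ proj₁ cayley (S.gen j) (S.⟨gen,w⟩≡1 j) ⟩
      + 1 ≡⟨ sym (S.⟨gen,w⟩≡1 j) ⟩
      dotℤ (S.gen j) n ∎

    L≢0 : ∀ i → Σ (Fin d) λ t → ¬ L i t ≡ + 0
    L≢0 i with proj₁ (proj₂ cayley) (unit i) (Σ-unit i)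
    ... | x , _ , Lx≡eᵢ = dot≢0⇒nonzero (L i) x
      (λ ⟨Lᵢ,x⟩≡0 → +1≢+0 (trans (sym (unit-diag i)) (trans (sym (Lx≡eᵢ i)) ⟨Lᵢ,x⟩≡0)))

    splitting : IsSplitting σ n m L
    splitting = (λ i → L∈σ∨ i , index-one L L∈σ∨ ΣL≡n L≢0 i) , ΣL≡n

  correspondence : Correspondence σ n m r
  correspondence =
    (λ (E , split) → E , FromSplitting.cayleyStructure E split) ,
    (λ (L , cayley) → L , FromCayleyStructure.splitting L cayley) ,
    (λ _ _ _ → refl) , (λ _ _ _ → refl)

  module FromCompletelySplitting
    (e : ℕ) (φ : LatticeIso d (e +ℕ r)) (k : Fin r → ℕ) (V : (i : Fin r) → Fin (k i) → Vecℤ e)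
    (σ≅Cayley : ∀ x → σ x ⇔ CayleyCone k V (applyIso φ x)) where

    Aφ : Z.Mat (e +ℕ r) d
    Aφ = proj₁ φ

    Bφ : Z.Mat d (e +ℕ r)
    Bφ = proj₁ (proj₂ φ)

    E : Fin r → Vecℤ d
    E i = Aφ (e ↑ʳ i)

    f : Vecℤ d
    f t = sumℤ (λ i → E i t)

    P : ∀ i → Fin (k i) → Vecℤ d
    P i l = Bφ Z.▷ liftPt (V i l) i

    P∈σ : ∀ i l → σ (toℚ (P i l))
    P∈σ i l = proj₂ (σ≅Cayley _)
      (CayleyCone-resp-≗ (CayleyCone-vertex k V i l) (λ t → sym (applyIso-inverse e φ (liftPt (V i l) i) t)))

    ⟨P,E⟩≡unit : ∀ i l i′ → dotℤ (P i l) (E i′) ≡ unit i i′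
    ⟨P,E⟩≡unit i l i′ = trans (Z.dot-comm (P i l) (E i′))
      (trans (Z.▷-cancel Aφ Bφ (proj₁ (proj₂ (proj₂ φ))) (liftPt (V i l) i) (e ↑ʳ i′)) (liftPt-↑ʳ (V i l) i i′))

    ⟨P,f⟩≡1 : ∀ i l → dotℤ (P i l) f ≡ + 1
    ⟨P,f⟩≡1 i l = trans (Z.dot-comm (P i l) f) (trans (sym (Σdot≡dotΣ E f (λ _ → refl) (P i l)))
      (trans (Z.Σ-cong (λ i′ → trans (Z.dot-comm (E i′) (P i l)) (⟨P,E⟩≡unit i l i′))) (Σ-unit i)))

    1≤⟨P,n⟩ : ∀ i l → + 1 ℤ.≤ dotℤ (P i l) n
    1≤⟨P,n⟩ i l with dot≢0⇒nonzero (P i l) f (λ ⟨P,f⟩≡0 → +1≢+0 (trans (sym (⟨P,f⟩≡1 i l)) ⟨P,f⟩≡0))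
    ... | t , Pₜ≢0 = S.nonzero⇒1≤⟨v,w⟩ (P i l) (P∈σ i l) t Pₜ≢0

    module Decompose {x : Vecℚ d} (x∈σ : σ x) where

      cayley : CayleyCone k V (applyIso φ x)
      cayley = proj₁ (σ≅Cayley x) x∈σ

      coeff : ∀ i → Fin (k i) → ℚ
      coeff i = proj₁ (proj₁ (proj₂ cayley) i)

      0≤coeff : ∀ i l → 0ℚ ℚ.≤ coeff i l
      0≤coeff i = proj₁ (proj₂ (proj₁ (proj₂ cayley) i))

      x≡ΣcoeffP : ∀ s → x s ≡ sumℚ (λ i → sumℚ (λ l → coeff i l ℚ.* toℚ (P i l) s))
      x≡ΣcoeffP s = begin
        x s ≡⟨ sym (inverse-applyIso e φ x s) ⟩
        (ιMat Bφ Q.▷ applyIso φ x) s ≡⟨ Q.▷-Σ (ιMat Bφ) (proj₁ cayley) (proj₂ (proj₂ cayley)) s ⟩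
        sumℚ (λ i → (ιMat Bφ Q.▷ proj₁ cayley i) s)
          ≡⟨ Q.Σ-cong (λ i → Q.▷-combination (ιMat Bφ) (coeff i) _ (proj₂ (proj₂ (proj₁ (proj₂ cayley) i))) s) ⟩
        sumℚ (λ i → sumℚ (λ l → coeff i l ℚ.* (ιMat Bφ Q.▷ toℚ (liftPt (V i l) i)) s))
          ≡⟨ Q.Σ-cong (λ i → Q.Σ-cong (λ l → cong (coeff i l ℚ.*_) (sym (ι-dot (Bφ s) (liftPt (V i l) i))))) ⟩
        sumℚ (λ i → sumℚ (λ l → coeff i l ℚ.* toℚ (P i l) s)) ∎

      ⟨x,w⟩≡ΣcoeffP : ∀ w → dotℚ x (toℚ w) ≡ sumℚ (λ i → sumℚ (λ l → coeff i l ℚ.* ι (dotℤ (P i l) w)))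
      ⟨x,w⟩≡ΣcoeffP w = begin
        dotℚ x (toℚ w) ≡⟨ Q.Σ-cong (λ s → cong (ℚ._* toℚ w s) (x≡ΣcoeffP s)) ⟩
        dotℚ (λ s → sumℚ (λ i → X i s)) (toℚ w) ≡⟨ Q.dot-Σˡ X (toℚ w) ⟩
        sumℚ (λ i → dotℚ (X i) (toℚ w))
          ≡⟨ Q.Σ-cong (λ i → Q.dot-combinationˡ (coeff i) (λ l → toℚ (P i l)) (λ _ → refl) (toℚ w)) ⟩
        sumℚ (λ i → sumℚ (λ l → coeff i l ℚ.* dotℚ (toℚ (P i l)) (toℚ w)))
          ≡⟨ Q.Σ-cong (λ i → Q.Σ-cong (λ l → cong (coeff i l ℚ.*_) (sym (ι-dot (P i l) w)))) ⟩
        sumℚ (λ i → sumℚ (λ l → coeff i l ℚ.* ι (dotℤ (P i l) w))) ∎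
        where
        X : Fin r → Vecℚ d
        X i s = sumℚ (λ l → coeff i l ℚ.* toℚ (P i l) s)

    E∈σ∨ : ∀ i → Dual σ (toℚ (E i))
    E∈σ∨ i x x∈σ = subst (0ℚ ℚ.≤_) (sym (⟨x,w⟩≡ΣcoeffP (E i)))
      (QO.Σ-nonneg (λ i′ → QO.Σ-nonneg (λ l →
        *-nonnegℚ (0≤coeff i′ l) (ι-mono-≤ (subst (+ 0 ℤ.≤_) (sym (⟨P,E⟩≡unit i′ l i)) (unit-nonneg i′ i))))))
      where open Decompose x∈σ

    -- Writing a generator g as Σ c P, ⟨g , f⟩ = Σ c while 1 = ⟨g , n⟩ = Σ c ⟨P , n⟩ ≥ Σ c;
    -- so the integer ⟨g , f⟩ lies in [0, 1] and vanishes only if all c do, which ⟨g , n⟩ = 1 forbids.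
    ⟨gen,f⟩≡1 : ∀ j → dotℤ (S.gen j) f ≡ + 1
    ⟨gen,f⟩≡1 j = ℤP.≤-antisym ⟨g,f⟩≤1 (nonneg∧≢0⇒≥1 _ 0≤⟨g,f⟩ ⟨g,f⟩≢0)
      where
      open Decompose (S.C-gen j)
      Σcoeff : ℚ
      Σcoeff = sumℚ (λ i → sumℚ (coeff i))
      ⟨g,f⟩≡Σcoeff : ι (dotℤ (S.gen j) f) ≡ Σcoeff
      ⟨g,f⟩≡Σcoeff = trans (ι-dot (S.gen j) f) (trans (⟨x,w⟩≡ΣcoeffP f) (Q.Σ-cong (λ i → Q.Σ-cong (λ l →
        trans (cong (λ z → coeff i l ℚ.* ι z) (⟨P,f⟩≡1 i l)) (ℚP.*-identityʳ (coeff i l))))))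
      1≡ΣcoeffP : 1ℚ ≡ sumℚ (λ i → sumℚ (λ l → coeff i l ℚ.* ι (dotℤ (P i l) n)))
      1≡ΣcoeffP = trans (cong ι (sym (S.⟨gen,w⟩≡1 j))) (trans (ι-dot (S.gen j) n) (⟨x,w⟩≡ΣcoeffP n))
      ⟨g,f⟩≤1 : dotℤ (S.gen j) f ℤ.≤ + 1
      ⟨g,f⟩≤1 = ι-cancel-≤ (subst₂ ℚ._≤_ (sym ⟨g,f⟩≡Σcoeff) (sym 1≡ΣcoeffP)
        (QO.Σ-mono-≤ (λ i → QO.Σ-mono-≤ (λ l → QO.a≤a*b (0≤coeff i l) (ι-mono-≤ (1≤⟨P,n⟩ i l))))))
      0≤⟨g,f⟩ : + 0 ℤ.≤ dotℤ (S.gen j) f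
      0≤⟨g,f⟩ = ι-cancel-≤ (subst (0ℚ ℚ.≤_) (sym ⟨g,f⟩≡Σcoeff) (QO.Σ-nonneg (λ i → QO.Σ-nonneg (0≤coeff i))))
      ⟨g,f⟩≢0 : ¬ dotℤ (S.gen j) f ≡ + 0
      ⟨g,f⟩≢0 ⟨g,f⟩≡0 = +1≢+0 (ι-injective (trans 1≡ΣcoeffP (Q.Σ-zero (λ i → Q.Σ-zero (λ l →
          trans (cong (ℚ._* ι (dotℤ (P i l) n)) (coeff≡0 i l)) (ℚP.*-zeroˡ (ι (dotℤ (P i l) n))))))))
        where
        coeff≡0 : ∀ i l → coeff i l ≡ 0ℚ
        coeff≡0 i = QO.Σ-nonneg≡0 (0≤coeff i) (QO.Σ-nonneg≡0 (λ i → QO.Σ-nonneg (0≤coeff i))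
          (trans (sym ⟨g,f⟩≡Σcoeff) (cong ι ⟨g,f⟩≡0)) i)

    ΣE≡n : ∀ t → sumℤ (λ i → E i t) ≡ n t
    ΣE≡n = S.agree-on-gens f n (λ j → trans (⟨gen,f⟩≡1 j) (sym (S.⟨gen,w⟩≡1 j)))

    E≢0 : ∀ i → Σ (Fin d) λ t → ¬ E i t ≡ + 0
    E≢0 i = dot≢0⇒nonzero (E i) (λ s → Bφ s (e ↑ʳ i))
      (λ ⟨E,B⟩≡0 → +1≢+0 (trans (sym (unit-diag (e ↑ʳ i)))
                                 (trans (sym (proj₁ (proj₂ (proj₂ φ)) _ _)) ⟨E,B⟩≡0)))

    splitting : IsSplitting σ n m E
    splitting = (λ i → E∈σ∨ i , index-one E E∈σ∨ ΣE≡n E≢0 i) , ΣE≡n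

  module ToCompletelySplitting (E : Fin r → Vecℤ d) (split : IsSplitting σ n m E) where

    open FromSplitting E split

    E⊙vertices≐I : E Z.⊙ (λ j i → S.gen (proj₁ (vertex i)) j) Z.≐ unit
    E⊙vertices≐I i i′ = trans (Z.dot-comm (E i) (S.gen (proj₁ (vertex i′)))) (trans (val-vertex i′ i) (Z.δ-sym i′ i))

    basis : ExtendsToBasis E
    basis = complement⇒extendsToBasis (complementOf r E _ E⊙vertices≐I)

    e : ℕ
    e = proj₁ basis

    φ : LatticeIso d (e +ℕ r)
    φ = proj₁ (proj₂ basis)

    Aφ : Z.Mat (e +ℕ r) d
    Aφ = proj₁ φ

    Aφ-↑ʳ : ∀ i j → Aφ (e ↑ʳ i) j ≡ E i j
    Aφ-↑ʳ = proj₂ (proj₂ basis)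

    π : Vecℤ d → Vecℤ e
    π v a = (Aφ Z.▷ v) (a ↑ˡ r)

    -- Generator j of σ, when ⟨gen j , E i⟩ = 1, lies over the i-th vertex of the simplex;
    -- other generators are replaced by the vertex generator of index i.
    choose : Fin r → Fin S.k → Fin S.k
    choose i j with val j i ℤ.≟ + 1
    ... | yes _ = j
    ... | no _ = proj₁ (vertex i)

    val-choose : ∀ i j → val (choose i j) i ≡ + 1
    val-choose i j with val j i ℤ.≟ + 1
    ... | yes val≡1 = val≡1
    ... | no _ = proj₂ (vertex i)

    choose-val≡1 : ∀ i j → val j i ≡ + 1 → choose i j ≡ j
    choose-val≡1 i j val≡1 with val j i ℤ.≟ + 1
    ... | yes _ = refl
    ... | no val≢1 = ⊥-elim (val≢1 val≡1)

    V : (i : Fin r) → Fin S.k → Vecℤ e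
    V i j = π (S.gen (choose i j))

    Aφ-gen-↑ʳ : ∀ j i → (Aφ Z.▷ S.gen j) (e ↑ʳ i) ≡ val j i
    Aφ-gen-↑ʳ j i = trans (Z.Σ-cong (λ s → cong (ℤ._* S.gen j s) (Aφ-↑ʳ i s))) (Z.dot-comm (E i) (S.gen j))

    Aφ-gen≡liftPt : ∀ j i → val j i ≡ + 1 → ∀ t → (Aφ Z.▷ S.gen j) t ≡ liftPt (π (S.gen j)) i t
    Aφ-gen≡liftPt j i val≡1 t = by-block (splitAt e t) refl
      where
      by-block : ∀ s → splitAt e t ≡ s → (Aφ Z.▷ S.gen j) t ≡ liftPt (π (S.gen j)) i t
      by-block (inj₁ a) eq = subst (λ t → (Aφ Z.▷ S.gen j) t ≡ liftPt (π (S.gen j)) i t) (splitAt⁻¹-↑ˡ eq)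
        (sym (liftPt-↑ˡ (π (S.gen j)) i a))
      by-block (inj₂ i′) eq = subst (λ t → (Aφ Z.▷ S.gen j) t ≡ liftPt (π (S.gen j)) i t) (splitAt⁻¹-↑ʳ eq)
        (trans (Aφ-gen-↑ʳ j i′) (trans (nonneg∧Σ≡1⇒≡unit (val j) (val-nonneg j) (Σval≡1 j) i val≡1 i′)
          (sym (liftPt-↑ʳ (π (S.gen j)) i i′))))

    vertex-lift : ∀ i j t → toℚ (liftPt (V i j) i) t ≡ applyIso φ (S.Gen (choose i j)) t
    vertex-lift i j t = trans (cong ι (sym (Aφ-gen≡liftPt (choose i j) i (val-choose i j) t)))
      (ι-dot (Aφ t) (S.gen (choose i j)))

    val·lift≡val·Agen : ∀ j i t →
      ι (val j i) ℚ.* toℚ (liftPt (V i j) i) t ≡ ι (val j i) ℚ.* applyIso φ (S.Gen j) t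
    val·lift≡val·Agen j i t = by-cases (nonneg∧Σ≡1⇒0or1 (val j) (val-nonneg j) (Σval≡1 j) i)
      where
      L G : ℚ
      L = toℚ (liftPt (V i j) i) t
      G = applyIso φ (S.Gen j) t
      vanish : val j i ≡ + 0 → ∀ q → ι (val j i) ℚ.* q ≡ 0ℚ
      vanish val≡0 q = trans (cong (λ v → ι v ℚ.* q) val≡0) (ℚP.*-zeroˡ q)
      L≡G : val j i ≡ + 1 → L ≡ G
      L≡G val≡1 = trans (vertex-lift i j t) (cong (λ j′ → applyIso φ (S.Gen j′) t) (choose-val≡1 i j val≡1))
      by-cases : val j i ≡ + 0 ⊎ val j i ≡ + 1 → ι (val j i) ℚ.* L ≡ ι (val j i) ℚ.* G
      by-cases (inj₁ val≡0) = trans (vanish val≡0 L) (sym (vanish val≡0 G))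
      by-cases (inj₂ val≡1) = cong (ι (val j i) ℚ.*_) (L≡G val≡1)

    σ⇒Cayley : ∀ x → σ x → CayleyCone (λ _ → S.k) V (applyIso φ x)
    σ⇒Cayley x x∈σ = c , c∈ , Ax≡Σc
      where
      coeff : Fin r → Fin S.k → ℚ
      coeff i j = ι (val j i) ℚ.* S.coeff x∈σ j
      c : Fin r → Vecℚ (e +ℕ r)
      c i t = sumℚ (λ j → coeff i j ℚ.* toℚ (liftPt (V i j) i) t)
      c∈ : ∀ i → InCone (λ j → toℚ (liftPt (V i j) i)) (c i)
      c∈ i = coeff i ,
        (λ j → *-nonnegℚ (ι-mono-≤ (val-nonneg j i)) (proj₁ (proj₂ (S.toCone x∈σ)) j)) , (λ _ → refl)
      Σι-val≡1 : ∀ j → sumℚ (λ i → ι (val j i)) ≡ 1ℚ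
      Σι-val≡1 j = trans (sym (ι-Σ (val j))) (cong ι (Σval≡1 j))
      split-over-vertices : ∀ j t →
        S.coeff x∈σ j ℚ.* applyIso φ (S.Gen j) t ≡ sumℚ (λ i → coeff i j ℚ.* toℚ (liftPt (V i j) i) t)
      split-over-vertices j t = begin
        a ℚ.* G ≡⟨ sym (ℚP.*-identityˡ (a ℚ.* G)) ⟩
        1ℚ ℚ.* (a ℚ.* G) ≡⟨ cong (ℚ._* (a ℚ.* G)) (sym (Σι-val≡1 j)) ⟩
        sumℚ (λ i → ι (val j i)) ℚ.* (a ℚ.* G) ≡⟨ Q.*-distribʳ-Σ (a ℚ.* G) (λ i → ι (val j i)) ⟩
        sumℚ (λ i → ι (val j i) ℚ.* (a ℚ.* G)) ≡⟨ Q.Σ-cong (λ i → regroup (ι (val j i)) a G) ⟩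
        sumℚ (λ i → a ℚ.* (ι (val j i) ℚ.* G)) ≡⟨ Q.Σ-cong (λ i → cong (a ℚ.*_) (sym (val·lift≡val·Agen j i t))) ⟩
        sumℚ (λ i → a ℚ.* (ι (val j i) ℚ.* L i)) ≡⟨ Q.Σ-cong (λ i → sym (regroup (ι (val j i)) a (L i))) ⟩
        sumℚ (λ i → ι (val j i) ℚ.* (a ℚ.* L i)) ≡⟨ Q.Σ-cong (λ i → sym (ℚP.*-assoc (ι (val j i)) a (L i))) ⟩
        sumℚ (λ i → coeff i j ℚ.* L i) ∎
        where
        a G : ℚ
        a = S.coeff x∈σ j
        G = applyIso φ (S.Gen j) t
        L : Fin r → ℚ
        L i = toℚ (liftPt (V i j) i) t
        regroup : ∀ u a g → u ℚ.* (a ℚ.* g) ≡ a ℚ.* (u ℚ.* g)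
        regroup u a g = trans (sym (ℚP.*-assoc u a g)) (trans (cong (ℚ._* g) (ℚP.*-comm u a)) (ℚP.*-assoc a u g))
      Ax≡Σc : ∀ t → applyIso φ x t ≡ sumℚ (λ i → c i t)
      Ax≡Σc t = begin
        applyIso φ x t ≡⟨ Q.▷-combination (ιMat Aφ) (S.coeff x∈σ) S.Gen (proj₂ (proj₂ (S.toCone x∈σ))) t ⟩
        sumℚ (λ j → S.coeff x∈σ j ℚ.* applyIso φ (S.Gen j) t) ≡⟨ Q.Σ-cong (λ j → split-over-vertices j t) ⟩
        sumℚ (λ j → sumℚ (λ i → coeff i j ℚ.* toℚ (liftPt (V i j) i) t))
          ≡⟨ Q.Σ-comm (λ j i → coeff i j ℚ.* toℚ (liftPt (V i j) i) t) ⟩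
        sumℚ (λ i → c i t) ∎

    Cayley⇒σ : ∀ x → CayleyCone (λ _ → S.k) V (applyIso φ x) → σ x
    Cayley⇒σ x (c , c∈ , Ax≡Σc) = S.C-resp-≗ y∈σ (λ s → sym (x≡y s))
      where
      coeff : ∀ i → Fin S.k → ℚ
      coeff i = proj₁ (c∈ i)
      Y : Fin r → Vecℚ d
      Y i s = sumℚ (λ j → coeff i j ℚ.* S.Gen (choose i j) s)
      y∈σ : σ (λ s → sumℚ (λ i → Y i s))
      y∈σ = S.C-Σ Y (λ i → S.C-Σ (λ j s → coeff i j ℚ.* S.Gen (choose i j) s)
        (λ j → S.C-scale (coeff i j) (proj₁ (proj₂ (c∈ i)) j) (S.C-gen _)))
      x≡y : ∀ s → x s ≡ sumℚ (λ i → Y i s)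
      x≡y s = begin
        x s ≡⟨ sym (inverse-applyIso e φ x s) ⟩
        (ιMat Bφ Q.▷ applyIso φ x) s ≡⟨ Q.▷-Σ (ιMat Bφ) c Ax≡Σc s ⟩
        sumℚ (λ i → (ιMat Bφ Q.▷ c i) s)
          ≡⟨ Q.Σ-cong (λ i → Q.▷-combination (ιMat Bφ) (coeff i) (λ j → toℚ (liftPt (V i j) i))
                                                (proj₂ (proj₂ (c∈ i))) s) ⟩
        sumℚ (λ i → sumℚ (λ j → coeff i j ℚ.* (ιMat Bφ Q.▷ toℚ (liftPt (V i j) i)) s))
          ≡⟨ Q.Σ-cong (λ i → Q.Σ-cong (λ j → cong (coeff i j ℚ.*_)
               (trans (Q.▷-cong (ιMat Bφ) (vertex-lift i j) s) (inverse-applyIso e φ (S.Gen (choose i j)) s)))) ⟩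
        sumℚ (λ i → Y i s) ∎
        where
        Bφ : Z.Mat d (e +ℕ r)
        Bφ = proj₁ (proj₂ φ)

    completelySplit : CompletelySplit σ r
    completelySplit = e , φ , (λ _ → S.k) , V , (λ x → σ⇒Cayley x , Cayley⇒σ x)

corollary2p5 : ∀ {d} (σ : Vecℚ d → Set) (n m : Vecℤ d) (r : ℕ)
    → IsGorenstein σ n
    → IsGorenstein (Dual σ) m
    → dotℤ m n ≡ + r
    → (CompletelySplit σ r ⇔ Σ (Fin r → Vecℤ d) (IsSplitting σ n m))
    × Correspondence σ n m r
corollary2p5 σ n m r Gσ Gσ∨ ⟨m,n⟩≡r =
  ( (λ (e , φ , k , V , σ≅Cayley) → let open FromCompletelySplitting e φ k V σ≅Cayley in E , splitting)
  , (λ (E , split) → ToCompletelySplitting.completelySplit E split) )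
  , correspondence
  where open ReflexivePair σ n m r Gσ Gσ∨ ⟨m,n⟩≡r
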